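{- Let $G$ be an $r$-regular simple graph on $n$ vertices, for some integer $r\ge 0$. Then the complement $\overline{G}$ has a matching covering at least $n-\frac{n}{n-r}$ vertices of $\overline{G}$.
   Context: $\overline{G}$ is the complement of $G$: same vertex set, with two distinct vertices adjacent in $\overline{G}$ iff they are non-adjacent in $G$. -}

module Defs where

open import Data.Nat using (ℕ)
open import Data.Bool using (Bool; true; false; not; _∧_)
open import Data.Fin using (Fin; _≟_)
open import Data.Fin.Properties using ()
open import Data.List using (List; []; _∷_; length; filter; allFin; concatMap)
open import Data.List.Relation.Unary.All using (All)
open import Data.List.Relation.Unary.Unique.Propositional using (Unique)
open import Data.Product using (_×_; _,_; proj₁; proj₂)
open import Relation.Binary.PropositionalEquality using (_≡_)
open import Relation.Nullary.Decidable using (⌊_⌋)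
open import Data.Bool.Properties using () renaming (_≟_ to _≟B_)

record SimpleGraph (n : ℕ) : Set where
  field
    adj   : Fin n → Fin n → Bool
    sym   : ∀ i j → adj i j ≡ adj j i
    loopless : ∀ i → adj i i ≡ false
open SimpleGraph public

degree : ∀ {n} → SimpleGraph n → Fin n → ℕ
degree G i = length (filter (λ j → adj G i j ≟B true) (allFin _))

Regular : ∀ {n} → SimpleGraph n → ℕ → Set
Regular G r = ∀ i → degree G i ≡ r

complementAdj : ∀ {n} → SimpleGraph n → Fin n → Fin n → Bool
complementAdj G i j = not (adj G i j) ∧ not ⌊ i ≟ j ⌋

record Matching {n : ℕ} (a : Fin n → Fin n → Bool) : Set where
  field
    edges    : List (Fin n × Fin n)
    isEdge   : All (λ e → a (proj₁ e) (proj₂ e) ≡ true) edges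
    disjoint : Unique (concatMap (λ e → proj₁ e ∷ proj₂ e ∷ []) edges)
open Matching public

covered : ∀ {n} {a : Fin n → Fin n → Bool} → Matching a → ℕ
covered M = length (concatMap (λ e → proj₁ e ∷ proj₂ e ∷ []) (edges M))

-- The complement H of an r-regular graph on n vertices is d-regular with d = n - 1 - r, and
-- n d = 2|E(H)|, so it suffices that |E| ≤ (Δ + 1) ν for every graph of maximum degree Δ.  We
-- prove this for every induced subgraph H[S], by induction on |S|.  If some vertex v is covered
-- by every maximum matching of H[S], then ν(S - v) = ν(S) - 1, while deleting v loses at most Δ
-- edges.  If S is disconnected, the bound adds up over a component and the rest.  Otherwise S is
-- connected and every vertex is missed by some maximum matching, so |S| = 2ν + 1 by Gallai's
-- lemma, and all degrees in H[S] are at most min(Δ, 2ν).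

module Submission where

open import Defs hiding (sym)
open import Data.Nat using (ℕ; _+_; _*_; _∸_; _≥_)
open import Data.Product using (Σ)

open import Data.Nat.Base using (zero; suc; _≤_; _<_; z≤n; s≤s; s≤s⁻¹)
open import Data.Nat.Properties
  using ( +-*-semiring; module ≤-Reasoning; _≤?_; ≤-refl; ≤-reflexive; ≤-trans; ≤-antisym; ≤-total; <⇒≤; <⇒≱; ≰⇒>
        ; ≤∧≢⇒<; <-≤-trans; n≤0⇒n≡0; n<1+n; m≤n+m; m<m+n; +-comm; +-assoc; +-suc; +-identityʳ; *-comm; *-suc
        ; *-zeroʳ; *-identityʳ; *-distribˡ-+; +-mono-≤; +-monoˡ-≤; +-monoʳ-≤; +-mono-<-≤; +-mono-≤-<; *-monoˡ-≤
        ; *-monoʳ-≤; +-cancelˡ-≤; +-cancelʳ-≤; +-cancelʳ-≡; m∸n+n≡m; m+n∸n≡m; m+[n∸m]≡n; m<n⇒0<n∸m; +-∸-assoc )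
open import Data.Bool.Base using (Bool; true; false; not; _∧_; _∨_; if_then_else_)
open import Data.Bool.Properties using (∧-conicalˡ; ∧-conicalʳ; ∧-zeroʳ; ∨-zeroʳ; ¬-not) renaming (_≟_ to _≟ᵇ_)
open import Data.Fin.Base using (Fin; zero; suc; toℕ; fromℕ<) renaming (_<_ to _<ᶠ_)
open import Data.Fin.Properties using (_≟_; _<?_; <-cmp; <-asym; <-irrefl; any?; all?; pigeonhole; toℕ-fromℕ<; suc-injective)
open import Data.Fin.Permutation using (permutation)
open import Relation.Binary.Definitions using (tri<; tri≈; tri>)
open import Data.Product.Base using (∃; _×_; _,_; proj₁; proj₂)
open import Data.Sum.Base using (_⊎_; inj₁; inj₂; [_,_]′)
open import Data.Empty using (⊥; ⊥-elim)
open import Function.Base using (_∘_; flip)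
open import Data.List.Base using (List; []; _∷_; length; filter; allFin; tabulate; map; concatMap)
import Data.List.Relation.Unary.All as All
open import Data.List.Relation.Unary.All using (All; []; _∷_)
import Data.List.Relation.Unary.All.Properties as All
open import Data.List.Relation.Unary.All.Properties using (all-filter)
open import Data.List.Relation.Unary.AllPairs using (AllPairs; []; _∷_)
import Data.List.Relation.Unary.AllPairs.Properties as AllPairs
open import Data.List.Relation.Unary.Unique.Propositional using (Unique)
import Data.List.Relation.Unary.Unique.Propositional.Properties as Unique
open import Data.List.Relation.Unary.Unique.Propositional.Properties using (concat⁺; allFin⁺)
open import Data.List.Relation.Unary.Any using (here; there)
open import Data.List.Relation.Binary.Disjoint.Propositional using (Disjoint)
open import Data.Nat.Tactic.RingSolver using (solve-∀)
open import Data.Nat.DivMod using (_%_; _/_; m≡m%n+[m/n]*n; m%n<n)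
open import Data.Nat.GeneralisedArithmetic using (fold; fold-+)
open import Data.Vec.Functional using (head; tail) renaming (_∷_ to _∷ᵛ_)
open import Relation.Nullary using (¬_; Dec; yes; no; does; ¬?; _×-dec_; _→-dec_)
open import Relation.Nullary.Decidable using (dec-true; dec-false; decidable-stable; isYes≗does)
open import Relation.Binary.PropositionalEquality
  using (_≡_; _≢_; _≗_; refl; sym; trans; cong; cong₂; subst; subst₂; module ≡-Reasoning)
open import Algebra.Properties.Semiring.Sum +-*-semiring
  using (sum; sum-cong-≗; ∑-distrib-+; ∑-comm; *-distribʳ-sum; sum-permute)

-- Subsets of Fin n and their sizes

𝟙 : Bool → ℕ
𝟙 true  = 1
𝟙 false = 0

count : ∀ {n} → (Fin n → Bool) → ℕ
count p = sum (𝟙 ∘ p)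

_⊆_ : ∀ {n} → (Fin n → Bool) → (Fin n → Bool) → Set
S ⊆ T = ∀ x → S x ≡ true → T x ≡ true

_∖_ : ∀ {n} → (Fin n → Bool) → (Fin n → Bool) → Fin n → Bool
(S ∖ T) x = S x ∧ not (T x)

∖-⊆ : ∀ {n} {S T : Fin n → Bool} → (S ∖ T) ⊆ S
∖-⊆ x = ∧-conicalˡ _ _

∖-out : ∀ {n} (S T : Fin n → Bool) x → T x ≡ true → (S ∖ T) x ≡ false
∖-out S T x Tx rewrite Tx = ∧-zeroʳ (S x)

sum-mono-≤ : ∀ {n} {f g : Fin n → ℕ} → (∀ x → f x ≤ g x) → sum f ≤ sum g
sum-mono-≤ {zero}  f≤g = z≤n
sum-mono-≤ {suc n} f≤g = +-mono-≤ (f≤g zero) (sum-mono-≤ (f≤g ∘ suc))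

sum-mono-< : ∀ {n} {f g : Fin n → ℕ} → (∀ x → f x ≤ g x) → ∀ z → f z < g z → sum f < sum g
sum-mono-< {suc n} f≤g zero    fz<gz = +-mono-<-≤ fz<gz (sum-mono-≤ (f≤g ∘ suc))
sum-mono-< {suc n} f≤g (suc z) fz<gz = +-mono-≤-< (f≤g zero) (sum-mono-< (f≤g ∘ suc) z fz<gz)

sum-const : ∀ {n} c → sum {n} (λ _ → c) ≡ n * c
sum-const {zero}  c = refl
sum-const {suc n} c = cong (c +_) (sum-const {n} c)

sum-zero : ∀ {n} {f : Fin n → ℕ} → (∀ x → f x ≡ 0) → sum f ≡ 0
sum-zero {n} f≡0 = trans (sum-cong-≗ f≡0) (trans (sum-const {n} 0) (*-zeroʳ n))

sum-single : ∀ {n} (f : Fin n → ℕ) v → (∀ x → x ≢ v → f x ≡ 0) → sum f ≡ f v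
sum-single {suc n} f zero    f≡0 = trans (cong (f zero +_) (sum-zero (λ x → f≡0 (suc x) λ ()))) (+-identityʳ _)
sum-single {suc n} f (suc v) f≡0 =
  cong₂ _+_ (f≡0 zero λ ()) (sum-single (f ∘ suc) v (λ x x≢v → f≡0 (suc x) (x≢v ∘ suc-injective)))

ΣΣ : ∀ {n} → (Fin n → Fin n → ℕ) → ℕ
ΣΣ f = sum λ x → sum λ y → f x y

ΣΣ-mono-≤ : ∀ {n} {f g : Fin n → Fin n → ℕ} → (∀ x y → f x y ≤ g x y) → ΣΣ f ≤ ΣΣ g
ΣΣ-mono-≤ f≤g = sum-mono-≤ λ x → sum-mono-≤ (f≤g x)

ΣΣ-distrib-+ : ∀ {n} (f g : Fin n → Fin n → ℕ) → ΣΣ (λ x y → f x y + g x y) ≡ ΣΣ f + ΣΣ g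
ΣΣ-distrib-+ f g = trans (sum-cong-≗ λ x → ∑-distrib-+ (f x) (g x)) (∑-distrib-+ (λ x → sum (f x)) (λ x → sum (g x)))

_≡ᵇ_ : ∀ {n} → Fin n → Fin n → Bool
x ≡ᵇ y = does (x ≟ y)

≡ᵇ-refl : ∀ {n} (x : Fin n) → (x ≡ᵇ x) ≡ true
≡ᵇ-refl x = dec-true (x ≟ x) refl

≢⇒≡ᵇ-false : ∀ {n} {x y : Fin n} → x ≢ y → (x ≡ᵇ y) ≡ false
≢⇒≡ᵇ-false {x = x} {y} = dec-false (x ≟ y)

from-does : ∀ {A : Set} (a? : Dec A) → does a? ≡ true → A
from-does (yes a) _ = a

≡ᵇ⇒≡ : ∀ {n} {x y : Fin n} → (x ≡ᵇ y) ≡ true → x ≡ y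
≡ᵇ⇒≡ {x = x} {y} = from-does (x ≟ y)

≡ᵇ-sym : ∀ {n} (x y : Fin n) → (x ≡ᵇ y) ≡ (y ≡ᵇ x)
≡ᵇ-sym x y with x ≟ y
... | yes refl = sym (≡ᵇ-refl x)
... | no  x≢y  = sym (≢⇒≡ᵇ-false (x≢y ∘ sym))

true≢false : ∀ {b} → b ≡ true → b ≢ false
true≢false refl ()

count-≤ : ∀ {n} (p : Fin n → Bool) → count p ≤ n
count-≤ {n} p = ≤-trans (sum-mono-≤ (𝟙≤1 ∘ p)) (≤-reflexive (trans (sum-const {n} 1) (*-identityʳ n)))
  where
  𝟙≤1 : ∀ b → 𝟙 b ≤ 1
  𝟙≤1 true  = ≤-refl
  𝟙≤1 false = z≤n

count-cong : ∀ {n} {p q : Fin n → Bool} → p ≗ q → count p ≡ count q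
count-cong p≗q = sum-cong-≗ (cong 𝟙 ∘ p≗q)

𝟙-mono : ∀ {b c} → (b ≡ true → c ≡ true) → 𝟙 b ≤ 𝟙 c
𝟙-mono {false} b⇒c = z≤n
𝟙-mono {true}  b⇒c rewrite b⇒c refl = ≤-refl

count-mono : ∀ {n} {p q : Fin n → Bool} → p ⊆ q → count p ≤ count q
count-mono p⊆q = sum-mono-≤ (𝟙-mono ∘ p⊆q)

count-mono-< : ∀ {n} {p q : Fin n → Bool} → p ⊆ q → ∀ z → p z ≡ false → q z ≡ true → count p < count q
count-mono-< p⊆q z pz qz = sum-mono-< (𝟙-mono ∘ p⊆q) z (subst₂ (λ b c → 𝟙 b < 𝟙 c) (sym pz) (sym qz) ≤-refl)

count-zero : ∀ {n} {p : Fin n → Bool} → (∀ x → p x ≡ false) → count p ≡ 0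
count-zero p≡false = sum-zero (cong 𝟙 ∘ p≡false)

count-≡ᵇ : ∀ {n} (v : Fin n) → count (_≡ᵇ v) ≡ 1
count-≡ᵇ v = trans (sum-single _ v (λ x x≢v → cong 𝟙 (≢⇒≡ᵇ-false x≢v))) (cong 𝟙 (≡ᵇ-refl v))

witness-or-count-zero : ∀ {n} (p : Fin n → Bool) → ∃ (λ x → p x ≡ true) ⊎ count p ≡ 0
witness-or-count-zero p with any? (λ x → p x ≟ᵇ true)
... | yes found = inj₁ found
... | no none   = inj₂ (count-zero absent)
  where
  absent : ∀ x → p x ≡ false
  absent x with p x in px
  ... | true  = ⊥-elim (none (x , px))
  ... | false = refl

count-pos⇒witness : ∀ {n} {p : Fin n → Bool} → 1 ≤ count p → ∃ λ x → p x ≡ true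
count-pos⇒witness {p = p} 1≤count with witness-or-count-zero p
... | inj₁ found = found
... | inj₂ none = ⊥-elim (<⇒≱ 1≤count (≤-reflexive none))

witness⇒count-pos : ∀ {n} {p : Fin n → Bool} z → p z ≡ true → 1 ≤ count p
witness⇒count-pos {p = p} z pz =
  subst (_≤ count p) (count-≡ᵇ z)
        (count-mono {p = _≡ᵇ z} (λ x x≡z → subst (λ y → p y ≡ true) (sym (≡ᵇ⇒≡ x≡z)) pz))

count-≤1 : ∀ {n} (p : Fin n → Bool) → (∀ x y → p x ≡ true → p y ≡ true → x ≡ y) → count p ≤ 1
count-≤1 p unique with witness-or-count-zero p
... | inj₁ (z , pz) = subst (count p ≤_) (count-≡ᵇ z) (count-mono (λ x px → dec-true (x ≟ z) (unique x z px pz)))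
... | inj₂ none     = ≤-trans (≤-reflexive none) z≤n

count-≥2 : ∀ {n} {p : Fin n → Bool} u v → u ≢ v → p u ≡ true → p v ≡ true → 2 ≤ count p
count-≥2 {p = p} u v u≢v pu pv = begin
  2                                ≡⟨ sym (cong₂ _+_ (count-≡ᵇ u) (count-≡ᵇ v)) ⟩
  count (_≡ᵇ u) + count (_≡ᵇ v)    ≡⟨ sym (∑-distrib-+ (𝟙 ∘ (_≡ᵇ u)) (𝟙 ∘ (_≡ᵇ v))) ⟩
  sum (λ x → 𝟙 (x ≡ᵇ u) + 𝟙 (x ≡ᵇ v)) ≤⟨ sum-mono-≤ pointwise ⟩
  count p                          ∎
  where
  open ≤-Reasoning
  pointwise : ∀ x → 𝟙 (x ≡ᵇ u) + 𝟙 (x ≡ᵇ v) ≤ 𝟙 (p x)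
  pointwise x with x ≟ u | x ≟ v
  ... | yes refl | yes refl = ⊥-elim (u≢v refl)
  ... | yes refl | no  _    = subst (λ b → 1 ≤ 𝟙 b) (sym pu) ≤-refl
  ... | no  _    | yes refl = subst (λ b → 1 ≤ 𝟙 b) (sym pv) ≤-refl
  ... | no  _    | no  _    = z≤n

count-≥2⇒other : ∀ {n} {p : Fin n → Bool} → 2 ≤ count p → ∀ w → ∃ λ z → p z ≡ true × z ≢ w
count-≥2⇒other {p = p} 2≤count w with any? (λ z → (p z ≟ᵇ true) ×-dec ¬? (z ≟ w))
... | yes found = found
... | no none    = ⊥-elim (<⇒≱ 2≤count (count-≤1 p (λ x y px py → trans (only-w x px) (sym (only-w y py)))))
  where
  only-w : ∀ x → p x ≡ true → x ≡ w
  only-w x px with x ≟ w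
  ... | yes x≡w = x≡w
  ... | no  x≢w = ⊥-elim (none (x , px , x≢w))

count-≥2⇒pair : ∀ {n} {p : Fin n → Bool} → 2 ≤ count p → ∃ λ u → ∃ λ v → p u ≡ true × p v ≡ true × u ≢ v
count-≥2⇒pair 2≤count with count-pos⇒witness (≤-trans (s≤s z≤n) 2≤count)
... | u , pu with count-≥2⇒other 2≤count u
...   | v , pv , v≢u = u , v , pu , pv , v≢u ∘ sym

count-shrinks : ∀ {n b} {S T : Fin n → Bool} → count S ≤ suc b → T ⊆ S →
                ∀ x → T x ≡ false → S x ≡ true → count T ≤ b
count-shrinks S≤b+1 T⊆S x Tx Sx = s≤s⁻¹ (≤-trans (count-mono-< T⊆S x Tx Sx) S≤b+1)

every-or-counterexample : ∀ {n} {P : Fin n → Set} → (∀ y → Dec (P y)) → (S : Fin n → Bool) →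
                          (∀ y → S y ≡ true → P y) ⊎ ∃ λ y → S y ≡ true × ¬ P y
every-or-counterexample P? S with any? (λ y → (S y ≟ᵇ true) ×-dec ¬? (P? y))
... | yes found = inj₂ found
... | no none   = inj₁ λ y Sy → decidable-stable (P? y) λ ¬Py → none (y , Sy , ¬Py)

⊆-or-witness : ∀ {n} (S T : Fin n → Bool) → S ⊆ T ⊎ ∃ λ y → S y ≡ true × T y ≡ false
⊆-or-witness S T with every-or-counterexample (λ y → T y ≟ᵇ true) S
... | inj₁ S⊆T           = inj₁ S⊆T
... | inj₂ (y , Sy , Ty) = inj₂ (y , Sy , ¬-not Ty)

-- Until it stabilises, the chain gains an element at every step, and Fin n has only n of them.
chain-stabilises : ∀ {n} (A : ℕ → Fin n → Bool) → (∀ k → A k ⊆ A (suc k)) →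
                   (∀ k → A (suc k) ⊆ A k → A (suc (suc k)) ⊆ A (suc k)) → A (suc n) ⊆ A n
chain-stabilises {n} A increasing stays with grows n
  where
  grows : ∀ k → A (suc k) ⊆ A k ⊎ k < count (A (suc k))
  grows k with ⊆-or-witness (A (suc k)) (A k)
  ... | inj₁ stable = inj₁ stable
  ... | inj₂ (y , new , old) with k
  ...   | zero  = inj₂ (witness⇒count-pos y new)
  ...   | suc j with grows j
  ...     | inj₁ stable = ⊥-elim (true≢false (stays j stable y new) old)
  ...     | inj₂ j<count = inj₂ (<-≤-trans (s≤s j<count) (count-mono-< (increasing (suc j)) y old new))
... | inj₁ stable = stable
... | inj₂ n<count = ⊥-elim (<⇒≱ n<count (count-≤ (A (suc n))))

any-function? : ∀ {m k} {Q : (Fin m → Fin k) → Set} → (∀ {f g} → f ≗ g → Q f → Q g) →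
                (∀ f → Dec (Q f)) → Dec (∃ Q)
any-function? {zero} resp Q? with Q? (λ ())
... | yes q = yes (_ , q)
... | no ¬q = no λ (f , q) → ¬q (resp (λ ()) q)
any-function? {suc m} {k} {Q} resp Q? with any? (λ x → any-function? (resp ∘ ∷-congʳ x) (Q? ∘ (x ∷ᵛ_)))
  where
  ∷-congʳ : ∀ x {g h : Fin m → Fin k} → g ≗ h → (x ∷ᵛ g) ≗ (x ∷ᵛ h)
  ∷-congʳ x g≗h zero    = refl
  ∷-congʳ x g≗h (suc i) = g≗h i
... | yes (x , g , q) = yes (x ∷ᵛ g , q)
... | no ¬q = no λ (f , q) → ¬q (head f , tail f , resp head∷tail q)
  where
  head∷tail : ∀ {f : Fin (suc m) → Fin k} → f ≗ (head f ∷ᵛ tail f)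
  head∷tail zero    = refl
  head∷tail (suc i) = refl

greatest : ∀ {P : ℕ → Set} → (∀ k → Dec (P k)) → P 0 → ∀ N → (∀ k → P k → k ≤ N) →
           ∃ λ k → P k × (∀ j → P j → j ≤ k)
greatest {P} P? P0 N bounded with P? N
... | yes PN = N , PN , bounded
greatest {P} P? P0 zero    bounded | no ¬P0 = ⊥-elim (¬P0 P0)
greatest {P} P? P0 (suc N) bounded | no ¬PN = greatest P? P0 N below
  where
  below : ∀ k → P k → k ≤ N
  below k Pk = s≤s⁻¹ (≤∧≢⇒< (bounded k Pk) λ { refl → ¬PN Pk })

-- Involutions and the number of points they move

Involutive : ∀ {n} → (Fin n → Fin n) → Set
Involutive σ = ∀ x → σ (σ x) ≡ x

fixedᵇ : ∀ {n} → (Fin n → Fin n) → Fin n → Bool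
fixedᵇ σ x = σ x ≡ᵇ x

moved : ∀ {n} → (Fin n → Fin n) → ℕ
moved σ = count (not ∘ fixedᵇ σ)

moved-cong : ∀ {n} {σ τ : Fin n → Fin n} → σ ≗ τ → moved σ ≡ moved τ
moved-cong σ≗τ = count-cong (λ x → cong (λ y → not (y ≡ᵇ x)) (σ≗τ x))

sum-involution : ∀ {n} {σ : Fin n → Fin n} → Involutive σ → (f : Fin n → ℕ) → sum f ≡ sum (f ∘ σ)
sum-involution inv f = sum-permute f (permutation _ _ inv inv)

ascents : ∀ {n} → (Fin n → Fin n) → ℕ
ascents σ = count (λ x → does (x <? σ x))

moved≡ascents+ascents : ∀ {n} {σ : Fin n → Fin n} → Involutive σ → moved σ ≡ ascents σ + ascents σ
moved≡ascents+ascents {σ = σ} inv = begin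
  moved σ                                                  ≡⟨ sum-cong-≗ (λ x → moved-or-ascent x (σ x)) ⟩
  sum (λ x → 𝟙 (does (x <? σ x)) + 𝟙 (does (σ x <? x)))    ≡⟨ ∑-distrib-+ (λ x → 𝟙 (does (x <? σ x))) descent ⟩
  ascents σ + sum descent                                  ≡⟨ cong (ascents σ +_) (sum-involution {σ = σ} inv descent) ⟩
  ascents σ + sum (λ x → 𝟙 (does (σ (σ x) <? σ x)))
    ≡⟨ cong (ascents σ +_) (sum-cong-≗ (λ x → cong (λ y → 𝟙 (does (y <? σ x))) (inv x))) ⟩
  ascents σ + ascents σ                                    ∎
  where
  open ≡-Reasoning
  descent : Fin _ → ℕ
  descent x = 𝟙 (does (σ x <? x))
  moved-or-ascent : ∀ x y → 𝟙 (not (y ≡ᵇ x)) ≡ 𝟙 (does (x <? y)) + 𝟙 (does (y <? x))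
  moved-or-ascent x y with <-cmp x y
  ... | tri< x<y x≢y _ rewrite ≢⇒≡ᵇ-false (x≢y ∘ sym) | dec-true (x <? y) x<y | dec-false (y <? x) (<-asym x<y) = refl
  ... | tri> _ x≢y y<x rewrite ≢⇒≡ᵇ-false (x≢y ∘ sym) | dec-false (x <? y) (<-asym y<x) | dec-true (y <? x) y<x = refl
  ... | tri≈ _ refl _  rewrite ≡ᵇ-refl x | dec-false (x <? x) (<-irrefl refl) = refl

moved-<⇒2+≤ : ∀ {n} {σ τ : Fin n → Fin n} → Involutive σ → Involutive τ →
              moved σ < moved τ → 2 + moved σ ≤ moved τ
moved-<⇒2+≤ {σ = σ} {τ} invσ invτ lt =
  subst₂ (λ a b → 2 + a ≤ b) (sym σ-even) (sym τ-even) (double-< (ascents σ) (ascents τ) (subst₂ _<_ σ-even τ-even lt))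
  where
  σ-even = moved≡ascents+ascents {σ = σ} invσ
  τ-even = moved≡ascents+ascents {σ = τ} invτ
  double-< : ∀ p q → p + p < q + q → 2 + (p + p) ≤ q + q
  double-< p q p+p<q+q with q ≤? p
  ... | yes q≤p = ⊥-elim (<⇒≱ p+p<q+q (+-mono-≤ q≤p q≤p))
  ... | no  q≰p = subst (_≤ q + q) (cong suc (+-suc p p)) (+-mono-≤ (≰⇒> q≰p) (≰⇒> q≰p))

moved-balance : ∀ {n} (σ τ : Fin n → Fin n) →
                moved σ + count (λ x → fixedᵇ σ x ∧ not (fixedᵇ τ x))
                  ≡ moved τ + count (λ x → not (fixedᵇ σ x) ∧ fixedᵇ τ x)
moved-balance σ τ = begin
  moved σ + count (λ x → fixedᵇ σ x ∧ not (fixedᵇ τ x))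
    ≡⟨ ∑-distrib-+ (𝟙 ∘ not ∘ fixedᵇ σ) (λ x → 𝟙 (fixedᵇ σ x ∧ not (fixedᵇ τ x))) ⟨
  sum (λ x → 𝟙 (not (fixedᵇ σ x)) + 𝟙 (fixedᵇ σ x ∧ not (fixedᵇ τ x)))
    ≡⟨ sum-cong-≗ (λ x → pointwise (fixedᵇ σ x) (fixedᵇ τ x)) ⟩
  sum (λ x → 𝟙 (not (fixedᵇ τ x)) + 𝟙 (not (fixedᵇ σ x) ∧ fixedᵇ τ x))
    ≡⟨ ∑-distrib-+ (𝟙 ∘ not ∘ fixedᵇ τ) (λ x → 𝟙 (not (fixedᵇ σ x) ∧ fixedᵇ τ x)) ⟩
  moved τ + count (λ x → not (fixedᵇ σ x) ∧ fixedᵇ τ x)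
    ∎
  where
  open ≡-Reasoning
  pointwise : ∀ a b → 𝟙 (not a) + 𝟙 (a ∧ not b) ≡ 𝟙 (not b) + 𝟙 (not a ∧ b)
  pointwise true  true  = refl
  pointwise true  false = refl
  pointwise false true  = refl
  pointwise false false = refl

more-than-moved⇒two-fixed : ∀ {n} (S : Fin n → Bool) σ → suc (moved σ) < count S → 2 ≤ count (λ x → S x ∧ fixedᵇ σ x)
more-than-moved⇒two-fixed S σ more =
  +-cancelˡ-≤ (moved σ) 2 _ (≤-trans (subst (_≤ count S) (+-comm 2 (moved σ)) more) (begin
    count S                                               ≤⟨ sum-mono-≤ (λ x → split (S x) (fixedᵇ σ x)) ⟩
    sum (λ x → 𝟙 (not (fixedᵇ σ x)) + 𝟙 (S x ∧ fixedᵇ σ x))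
      ≡⟨ ∑-distrib-+ (𝟙 ∘ not ∘ fixedᵇ σ) (λ x → 𝟙 (S x ∧ fixedᵇ σ x)) ⟩
    moved σ + count (λ x → S x ∧ fixedᵇ σ x)              ∎))
  where
  open ≤-Reasoning
  split : ∀ a b → 𝟙 a ≤ 𝟙 (not b) + 𝟙 (a ∧ b)
  split true  true  = ≤-refl
  split true  false = ≤-refl
  split false b     = z≤n

-- Switching between two involutions on an invariant set

switch : ∀ {n} → (Fin n → Bool) → (Fin n → Fin n) → (Fin n → Fin n) → Fin n → Fin n
switch K σ τ x = if K x then σ x else τ x

Invariant : ∀ {n} → (Fin n → Bool) → (Fin n → Fin n) → Set
Invariant K σ = ∀ x → K x ≡ true → K (σ x) ≡ true

switch-involutive : ∀ {n} {K : Fin n → Bool} {σ τ} → Involutive σ → Involutive τ →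
                    Invariant K σ → Invariant K τ → Involutive (switch K σ τ)
switch-involutive {K = K} {σ} {τ} invσ invτ Kσ Kτ x with K x in Kx
... | true rewrite Kσ x Kx = invσ x
... | false with K (τ x) in Kτx
...   | true  = ⊥-elim (true≢false (subst (λ y → K y ≡ true) (invτ x) (Kτ (τ x) Kτx)) Kx)
...   | false = invτ x

moved-switch : ∀ {n} (K : Fin n → Bool) σ τ →
               moved (switch K σ τ) + count (λ x → K x ∧ fixedᵇ σ x) ≡ moved τ + count (λ x → K x ∧ fixedᵇ τ x)
moved-switch K σ τ = begin
  moved (switch K σ τ) + count (λ x → K x ∧ fixedᵇ σ x)
    ≡⟨ ∑-distrib-+ (𝟙 ∘ not ∘ fixedᵇ (switch K σ τ)) (λ x → 𝟙 (K x ∧ fixedᵇ σ x)) ⟨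
  sum (λ x → 𝟙 (not (fixedᵇ (switch K σ τ) x)) + 𝟙 (K x ∧ fixedᵇ σ x))
    ≡⟨ sum-cong-≗ pointwise ⟩
  sum (λ x → 𝟙 (not (fixedᵇ τ x)) + 𝟙 (K x ∧ fixedᵇ τ x))
    ≡⟨ ∑-distrib-+ (𝟙 ∘ not ∘ fixedᵇ τ) (λ x → 𝟙 (K x ∧ fixedᵇ τ x)) ⟩
  moved τ + count (λ x → K x ∧ fixedᵇ τ x)
    ∎
  where
  open ≡-Reasoning
  𝟙-not : ∀ b → 𝟙 (not b) + 𝟙 b ≡ 1
  𝟙-not true  = refl
  𝟙-not false = refl
  pointwise : ∀ x → 𝟙 (not (fixedᵇ (switch K σ τ) x)) + 𝟙 (K x ∧ fixedᵇ σ x)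
                    ≡ 𝟙 (not (fixedᵇ τ x)) + 𝟙 (K x ∧ fixedᵇ τ x)
  pointwise x with K x
  ... | true  = trans (𝟙-not (fixedᵇ σ x)) (sym (𝟙-not (fixedᵇ τ x)))
  ... | false = refl

moved-switch-disjoint : ∀ {n} (K : Fin n → Bool) σ τ →
                        (∀ x → K x ≡ true → τ x ≡ x) → (∀ x → K x ≡ false → σ x ≡ x) →
                        moved (switch K σ τ) ≡ moved σ + moved τ
moved-switch-disjoint K σ τ τ-fixes-K σ-fixes-rest =
  trans (sum-cong-≗ pointwise) (∑-distrib-+ (𝟙 ∘ not ∘ fixedᵇ σ) (𝟙 ∘ not ∘ fixedᵇ τ))
  where
  pointwise : ∀ x → 𝟙 (not (fixedᵇ (switch K σ τ) x)) ≡ 𝟙 (not (fixedᵇ σ x)) + 𝟙 (not (fixedᵇ τ x))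
  pointwise x with K x in Kx
  ... | true  rewrite τ-fixes-K x Kx | ≡ᵇ-refl x = sym (+-identityʳ _)
  ... | false rewrite σ-fixes-rest x Kx | ≡ᵇ-refl x = refl

augment : ∀ {n} → Fin n → Fin n → (Fin n → Fin n) → Fin n → Fin n
augment u v σ x = if x ≡ᵇ u then v else (if x ≡ᵇ v then u else σ x)

fold-suc : ∀ {A : Set} (y : A) f k → fold y f (suc k) ≡ fold (f y) f k
fold-suc y f k = trans (cong (fold y f) (+-comm 1 k)) (fold-+ y f k)

fold-periodic : ∀ {A : Set} {x : A} {f} a → fold x f a ≡ x → ∀ c → fold x f (c * a) ≡ x
fold-periodic a period zero    = refl
fold-periodic {x = x} {f} a period (suc c) =
  trans (fold-+ x f a) (trans (cong (λ y → fold y f a) (fold-periodic a period c)) period)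

fold-inverse : ∀ {A : Set} {f g : A → A} → (∀ y → g (f y) ≡ y) → ∀ k y → fold (fold y f k) g k ≡ y
fold-inverse         g∘f≗id zero    y = refl
fold-inverse {f = f} {g} g∘f≗id (suc k) y =
  trans (cong (λ w → g (fold w g k)) (fold-suc y f k)) (trans (cong g (fold-inverse g∘f≗id k (f y))) (g∘f≗id y))

fold-conjugate : ∀ {A : Set} {f g h : A → A} → (∀ y → g (f y) ≡ h (g y)) → ∀ k y → g (fold y f k) ≡ fold (g y) h k
fold-conjugate         g∘f≗h∘g zero    y = refl
fold-conjugate {f = f} {g} {h} g∘f≗h∘g (suc k) y = trans (g∘f≗h∘g (fold y f k)) (cong h (fold-conjugate g∘f≗h∘g k y))

orbit-returns : ∀ {n} {f g : Fin n → Fin n} → (∀ y → g (f y) ≡ y) → ∀ z → ∃ λ p → fold z f (suc p) ≡ z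
orbit-returns {n} {f} {g} g∘f≗id z with pigeonhole (n<1+n n) (λ (i : Fin (suc n)) → fold z f (toℕ i))
... | i , j , i<j , same = toℕ j ∸ toℕ i ∸ 1 , subst (λ d → fold z f d ≡ z) d≡suc returns
  where
  open ≡-Reasoning
  d = toℕ j ∸ toℕ i
  d≡suc : d ≡ suc (d ∸ 1)
  d≡suc = sym (trans (+-comm 1 (d ∸ 1)) (m∸n+n≡m (m<n⇒0<n∸m i<j)))
  returns : fold z f d ≡ z
  returns = begin
    fold z f d                                   ≡⟨ fold-inverse g∘f≗id (toℕ i) _ ⟨
    fold (fold (fold z f d) f (toℕ i)) g (toℕ i) ≡⟨ cong (λ y → fold y g (toℕ i)) (fold-+ z f (toℕ i)) ⟨
    fold (fold z f (toℕ i + d)) g (toℕ i)        ≡⟨ cong (λ k → fold (fold z f k) g (toℕ i)) (m+[n∸m]≡n (<⇒≤ i<j)) ⟩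
    fold (fold z f (toℕ j)) g (toℕ i)            ≡⟨ cong (λ y → fold y g (toℕ i)) same ⟨
    fold (fold z f (toℕ i)) g (toℕ i)            ≡⟨ fold-inverse g∘f≗id (toℕ i) z ⟩
    z                                            ∎

-- The component of z in the union of two involutions σ, τ with τ z = z ≠ σ z is an alternating
-- path starting at z.  If it ends with a σ-step, both its ends are τ-fixed and σ moves all of
-- it; otherwise z is its only τ-fixed point and its other end is its only σ-fixed point.
-- We reach it as the orbit of z under ρ = σ ∘ τ, which walks along the path and back.

module AlternatingPath {n} (σ τ : Fin n → Fin n) (invσ : Involutive σ) (invτ : Involutive τ)
                       {z : Fin n} (τz≡z : τ z ≡ z) (σz≢z : σ z ≢ z) where

  ρ ρ⁻¹ : Fin n → Fin n
  ρ   = σ ∘ τ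
  ρ⁻¹ = τ ∘ σ

  ρ⁻¹∘ρ : ∀ y → ρ⁻¹ (ρ y) ≡ y
  ρ⁻¹∘ρ y = trans (cong τ (invσ (τ y))) (invτ y)

  ρ∘ρ⁻¹ : ∀ y → ρ (ρ⁻¹ y) ≡ y
  ρ∘ρ⁻¹ y = trans (cong σ (invτ (σ y))) (invσ y)

  X : ℕ → Fin n
  X = fold z ρ

  p : ℕ
  p = proj₁ (orbit-returns {f = ρ} {ρ⁻¹} ρ⁻¹∘ρ z)

  X[1+p]≡z : X (suc p) ≡ z
  X[1+p]≡z = proj₂ (orbit-returns {f = ρ} {ρ⁻¹} ρ⁻¹∘ρ z)

  X-+ : ∀ a b → X (a + b) ≡ fold (X b) ρ a
  X-+ a b = fold-+ z ρ a

  X-mod : ∀ m → X m ≡ X (m % suc p)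
  X-mod m = begin
    X m                                           ≡⟨ cong X (m≡m%n+[m/n]*n m (suc p)) ⟩
    X (m % suc p + (m / suc p) * suc p)           ≡⟨ X-+ (m % suc p) _ ⟩
    fold (X ((m / suc p) * suc p)) ρ (m % suc p)
      ≡⟨ cong (λ y → fold y ρ (m % suc p)) (fold-periodic {f = ρ} (suc p) X[1+p]≡z (m / suc p)) ⟩
    X (m % suc p)                                 ∎
    where open ≡-Reasoning

  K : Fin n → Bool
  K x = does (any? (λ (k : Fin (suc p)) → X (toℕ k) ≟ x))

  K-X : ∀ m → K (X m) ≡ true
  K-X m = dec-true (any? (λ (k : Fin (suc p)) → X (toℕ k) ≟ X m))
                   (fromℕ< (m%n<n m (suc p)) , trans (cong X (toℕ-fromℕ< (m%n<n m (suc p)))) (sym (X-mod m)))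

  K⇒X : ∀ x → K x ≡ true → ∃ λ k → X k ≡ x
  K⇒X x Kx with from-does (any? (λ (k : Fin (suc p)) → X (toℕ k) ≟ x)) Kx
  ... | k , Xk≡x = toℕ k , Xk≡x

  ρ⁻¹-X : ∀ k → ρ⁻¹ (X k) ≡ X (k + p)
  ρ⁻¹-X k = begin
    ρ⁻¹ (X k)                ≡⟨ cong (λ y → ρ⁻¹ (fold y ρ k)) X[1+p]≡z ⟨
    ρ⁻¹ (fold (X (suc p)) ρ k) ≡⟨ cong ρ⁻¹ (X-+ k (suc p)) ⟨
    ρ⁻¹ (X (k + suc p))      ≡⟨ cong (ρ⁻¹ ∘ X) (+-suc k p) ⟩
    ρ⁻¹ (ρ (X (k + p)))      ≡⟨ ρ⁻¹∘ρ _ ⟩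
    X (k + p)                ∎
    where open ≡-Reasoning

  K-ρ⁻¹ : ∀ j k → ∃ λ m → fold (X k) ρ⁻¹ j ≡ X m
  K-ρ⁻¹ zero    k = k , refl
  K-ρ⁻¹ (suc j) k with K-ρ⁻¹ j k
  ... | m , eq = m + p , trans (cong ρ⁻¹ eq) (ρ⁻¹-X m)

  σ-X : ∀ k → σ (X k) ≡ fold (X 1) ρ⁻¹ k
  σ-X k = trans (fold-conjugate {f = ρ} {σ} (λ y → trans (invσ (τ y)) (sym (cong τ (invσ y)))) k z)
                (cong (λ y → fold (σ y) ρ⁻¹ k) (sym τz≡z))

  τ-X : ∀ k → τ (X k) ≡ fold z ρ⁻¹ k
  τ-X k = trans (fold-conjugate {f = ρ} {τ} {ρ⁻¹} (λ y → refl) k z) (cong (λ y → fold y ρ⁻¹ k) τz≡z)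

  K-invariant : ∀ {π} → (∀ k → ∃ λ m → π (X k) ≡ X m) → Invariant K π
  K-invariant π-X x Kx with K⇒X x Kx
  ... | k , refl with π-X k
  ...   | m , eq = subst (λ y → K y ≡ true) (sym eq) (K-X m)

  K-σ : Invariant K σ
  K-σ = K-invariant (λ k → let m , eq = K-ρ⁻¹ k 1 in m , trans (σ-X k) eq)

  K-τ : Invariant K τ
  K-τ = K-invariant (λ k → let m , eq = K-ρ⁻¹ k 0 in m , trans (τ-X k) eq)

  τ-fixed : ∀ k → τ (X k) ≡ X k → X (k + k) ≡ z
  τ-fixed k τXk≡Xk = begin
    X (k + k)                  ≡⟨ X-+ k k ⟩
    fold (X k) ρ k             ≡⟨ cong (λ y → fold y ρ k) τXk≡Xk ⟨
    fold (τ (X k)) ρ k         ≡⟨ cong (λ y → fold y ρ k) (τ-X k) ⟩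
    fold (fold z ρ⁻¹ k) ρ k    ≡⟨ fold-inverse {f = ρ⁻¹} {ρ} ρ∘ρ⁻¹ k z ⟩
    z                          ∎
    where open ≡-Reasoning

  σ-fixed : ∀ k → σ (X k) ≡ X k → ∃ λ m → k ≡ suc m × X (suc (m + m)) ≡ z
  σ-fixed zero    σz≡z = ⊥-elim (σz≢z σz≡z)
  σ-fixed (suc m) σXk≡Xk = m , refl , (begin
    X (suc (m + m))          ≡⟨ cong X (+-suc m m) ⟨
    X (m + suc m)            ≡⟨ ρ⁻¹∘ρ _ ⟨
    ρ⁻¹ (X (suc m + suc m))  ≡⟨ cong ρ⁻¹ X[1]≡X[k+k] ⟨
    ρ⁻¹ (ρ z)                ≡⟨ ρ⁻¹∘ρ z ⟩
    z                        ∎)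
    where
    open ≡-Reasoning
    k = suc m
    X[1]≡X[k+k] : X 1 ≡ X (k + k)
    X[1]≡X[k+k] = begin
      X 1                          ≡⟨ fold-inverse {f = ρ⁻¹} {ρ} ρ∘ρ⁻¹ k (X 1) ⟨
      fold (fold (X 1) ρ⁻¹ k) ρ k  ≡⟨ cong (λ y → fold y ρ k) (σ-X k) ⟨
      fold (σ (X k)) ρ k           ≡⟨ cong (λ y → fold y ρ k) σXk≡Xk ⟩
      fold (X k) ρ k               ≡⟨ X-+ k k ⟨
      X (k + k)                    ∎

  even-and-odd-return : ∀ j m → X (j + j) ≡ z → X (suc (m + m)) ≡ z → X j ≡ z
  even-and-odd-return j m even odd = begin
    X j                                   ≡⟨ cong (λ y → fold y ρ j) (fold-periodic (suc (m + m)) odd j) ⟨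
    fold (X (j * suc (m + m))) ρ j        ≡⟨ X-+ j _ ⟨
    X (j + j * suc (m + m))               ≡⟨ cong X (j+j[1+2m]≡[1+m][2j] j m) ⟩
    X (suc m * (j + j))                   ≡⟨ fold-periodic (j + j) even (suc m) ⟩
    z                                     ∎
    where
    open ≡-Reasoning
    j+j[1+2m]≡[1+m][2j] : ∀ j m → j + j * suc (m + m) ≡ suc m * (j + j)
    j+j[1+2m]≡[1+m][2j] = solve-∀

  odd-returns-agree : ∀ m₁ m₂ → m₁ ≤ m₂ → X (suc (m₁ + m₁)) ≡ z → X (suc (m₂ + m₂)) ≡ z →
                      X (suc m₁) ≡ X (suc m₂)
  odd-returns-agree m₁ m₂ m₁≤m₂ odd₁ odd₂ = sym (begin
    X (suc m₂)                   ≡⟨ cong (X ∘ suc) (m+[n∸m]≡n m₁≤m₂) ⟨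
    X (suc m₁ + d)               ≡⟨ X-+ (suc m₁) d ⟩
    fold (X d) ρ (suc m₁)        ≡⟨ cong (λ y → fold y ρ (suc m₁)) (even-and-odd-return d m₁ X[d+d]≡z odd₁) ⟩
    X (suc m₁)                   ∎)
    where
    open ≡-Reasoning
    d = m₂ ∸ m₁
    shift : ∀ m d → suc (m + d + (m + d)) ≡ (d + d) + suc (m + m)
    shift = solve-∀
    X[d+d]≡z : X (d + d) ≡ z
    X[d+d]≡z = begin
      X (d + d)                               ≡⟨ cong (λ y → fold y ρ (d + d)) odd₁ ⟨
      fold (X (suc (m₁ + m₁))) ρ (d + d)      ≡⟨ X-+ (d + d) _ ⟨
      X ((d + d) + suc (m₁ + m₁))             ≡⟨ cong X (shift m₁ d) ⟨
      X (suc (m₁ + d + (m₁ + d)))             ≡⟨ cong (λ m → X (suc (m + m))) (m+[n∸m]≡n m₁≤m₂) ⟩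
      X (suc (m₂ + m₂))                       ≡⟨ odd₂ ⟩
      z                                       ∎

  σ-fixed-unique : ∀ x y → K x ≡ true → K y ≡ true → σ x ≡ x → σ y ≡ y → x ≡ y
  σ-fixed-unique x y Kx Ky σx≡x σy≡y with K⇒X x Kx | K⇒X y Ky
  ... | k₁ , refl | k₂ , refl with σ-fixed k₁ σx≡x | σ-fixed k₂ σy≡y
  ...   | m₁ , refl , odd₁ | m₂ , refl , odd₂ with ≤-total m₁ m₂
  ...     | inj₁ m₁≤m₂ = odd-returns-agree m₁ m₂ m₁≤m₂ odd₁ odd₂
  ...     | inj₂ m₂≤m₁ = sym (odd-returns-agree m₂ m₁ m₂≤m₁ odd₂ odd₁)

  shape : (∀ x → K x ≡ true → σ x ≢ x) ⊎ (∀ x → K x ≡ true → τ x ≡ x → x ≡ z)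
  shape with any? (λ x → (K x ≟ᵇ true) ×-dec (σ x ≟ x))
  ... | no none = inj₁ (λ x Kx σx≡x → none (x , Kx , σx≡x))
  ... | yes (y , Ky , σy≡y) with K⇒X y Ky
  ...   | k , refl with σ-fixed k σy≡y
  ...     | m , refl , odd = inj₂ only-z
    where
    only-z : ∀ x → K x ≡ true → τ x ≡ x → x ≡ z
    only-z x Kx τx≡x with K⇒X x Kx
    ... | j , refl = even-and-odd-return j m (τ-fixed j τx≡x) odd

-- Edge lists of involutions

ascending : ∀ {n} → (Fin n → Fin n) → List (Fin n)
ascending {n} σ = filter (λ x → x <? σ x) (allFin n)

length-filter-tabulate : ∀ {m n} {P : Fin n → Set} (P? : ∀ x → Dec (P x)) (f : Fin m → Fin n) →
                         length (filter P? (tabulate f)) ≡ sum (λ i → 𝟙 (does (P? (f i))))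
length-filter-tabulate {zero}  P? f = refl
length-filter-tabulate {suc m} P? f with does (P? (f zero))
... | true  = cong suc (length-filter-tabulate P? (f ∘ suc))
... | false = length-filter-tabulate P? (f ∘ suc)

length-ascending : ∀ {n} (σ : Fin n → Fin n) → length (ascending σ) ≡ ascents σ
length-ascending σ = length-filter-tabulate (λ x → x <? σ x) (λ x → x)

ascent-≢-partner : ∀ {n} {σ : Fin n → Fin n} → Involutive σ → ∀ {a b} → a <ᶠ σ a → b <ᶠ σ b → a ≢ σ b
ascent-≢-partner {σ = σ} inv {a} {b} a<σa b<σb a≡σb =
  <-asym b<σb (subst₂ _<ᶠ_ a≡σb (trans (cong σ a≡σb) (inv b)) a<σa)

pair-disjoint : ∀ {n} {σ : Fin n → Fin n} → Involutive σ → ∀ {x y} → x <ᶠ σ x → y <ᶠ σ y → x ≢ y →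
                Disjoint (x ∷ σ x ∷ []) (y ∷ σ y ∷ [])
pair-disjoint {σ = σ} inv {x} {y} x<σx y<σy x≢y (v∈x , v∈y) with v∈x | v∈y
... | here v≡x          | here v≡y          = x≢y (trans (sym v≡x) v≡y)
... | here v≡x          | there (here v≡σy) = ascent-≢-partner inv x<σx y<σy (trans (sym v≡x) v≡σy)
... | there (here v≡σx) | here v≡y          = ascent-≢-partner inv y<σy x<σx (trans (sym v≡y) v≡σx)
... | there (here v≡σx) | there (here v≡σy) = x≢y (trans (sym (inv x)) (trans (cong σ (trans (sym v≡σx) v≡σy)) (inv y)))

endpoints : ∀ {n} → List (Fin n × Fin n) → List (Fin n)
endpoints = concatMap (λ e → proj₁ e ∷ proj₂ e ∷ [])

length-endpoints : ∀ {n} (σ : Fin n → Fin n) xs → length (endpoints (map (λ x → x , σ x) xs)) ≡ length xs + length xs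
length-endpoints σ []       = refl
length-endpoints σ (x ∷ xs) = cong suc (trans (cong suc (length-endpoints σ xs)) (sym (+-suc (length xs) (length xs))))

endpoints-unique : ∀ {n} {σ : Fin n → Fin n} → Involutive σ → Unique (endpoints (map (λ x → x , σ x) (ascending σ)))
endpoints-unique {n} {σ} inv =
  concat⁺ (All.map⁺ (All.map⁺ (All.map pair-unique ascend)))
          (AllPairs.map⁺ (AllPairs.map⁺ (disjoint-pairs ascend (Unique.filter⁺ (λ x → x <? σ x) (allFin⁺ n)))))
  where
  ascend : All (λ x → x <ᶠ σ x) (ascending σ)
  ascend = all-filter (λ x → x <? σ x) (allFin n)
  pair-unique : ∀ {x} → x <ᶠ σ x → Unique (x ∷ σ x ∷ [])
  pair-unique x<σx = ((λ x≡σx → <-irrefl x≡σx x<σx) ∷ []) ∷ [] ∷ []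
  disjoint-pairs : ∀ {xs} → All (λ x → x <ᶠ σ x) xs → Unique xs →
                   AllPairs (λ x y → Disjoint (x ∷ σ x ∷ []) (y ∷ σ y ∷ [])) xs
  disjoint-pairs []                 []                = []
  disjoint-pairs {x ∷ _} (x<σx ∷ ascending) (x∉xs ∷ unique) =
    All.zipWith {R = λ y → Disjoint (x ∷ σ x ∷ []) (y ∷ σ y ∷ [])} (λ (y<σy , x≢y) → pair-disjoint inv x<σx y<σy x≢y)
                (ascending , x∉xs) ∷ disjoint-pairs ascending unique

-- Degree sum d of s ≤ c + 1 vertices whose degrees are at most Δ and at most s - 1.
near-perfect-bound : ∀ {d s c Δ} → d ≤ s * Δ → d + s ≤ s * s → s ≤ suc c → d ≤ suc Δ * c
near-perfect-bound {d} {zero}  {c} {Δ} d≤sΔ _ _ = ≤-trans d≤sΔ z≤n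
near-perfect-bound {d} {suc t} {c} {Δ} d≤sΔ d+s≤s² (s≤s t≤c) = ≤-trans d≤[1+Δ]t (*-monoʳ-≤ (suc Δ) t≤c)
  where
  d≤[1+Δ]t : d ≤ suc Δ * t
  d≤[1+Δ]t with t ≤? Δ
  ... | yes t≤Δ = ≤-trans d≤[1+t]t (*-monoˡ-≤ t (s≤s t≤Δ))
    where
    d≤[1+t]t : d ≤ suc t * t
    d≤[1+t]t = +-cancelʳ-≤ (suc t) d (suc t * t) (≤-trans d+s≤s² (≤-reflexive (trans (*-suc (suc t) t) (+-comm (suc t) _))))
  ... | no  t≰Δ = begin
    d                 ≤⟨ d≤sΔ ⟩
    suc t * Δ         ≡⟨ *-comm (suc t) Δ ⟩
    Δ * suc t         ≡⟨ *-suc Δ t ⟩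
    Δ + Δ * t         ≤⟨ +-monoˡ-≤ (Δ * t) (<⇒≤ (≰⇒> t≰Δ)) ⟩
    t + Δ * t         ∎
    where open ≤-Reasoning

-- A matching of H[S] is an involution of the vertices that swaps the ends of each matching edge
-- and fixes every other vertex, so that moved σ is the number of vertices it covers.
record IsMatching {n} (H : SimpleGraph n) (S : Fin n → Bool) (σ : Fin n → Fin n) : Set where
  field
    involutive : Involutive σ
    matched    : ∀ x → σ x ≢ x → S x ≡ true × adj H x (σ x) ≡ true
open IsMatching

IsMaximum : ∀ {n} (H : SimpleGraph n) (S : Fin n → Bool) (σ : Fin n → Fin n) → Set
IsMaximum H S σ = IsMatching H S σ × (∀ τ → IsMatching H S τ → moved τ ≤ moved σ)

module _ {n : ℕ} (H : SimpleGraph n) where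

  isMatching? : ∀ S σ → Dec (IsMatching H S σ)
  isMatching? S σ with all? (λ x → σ (σ x) ≟ x)
                     | all? (λ x → ¬? (σ x ≟ x) →-dec ((S x ≟ᵇ true) ×-dec (adj H x (σ x) ≟ᵇ true)))
  ... | yes inv | yes edge = yes record { involutive = inv ; matched = edge }
  ... | no ¬inv | _        = no (¬inv ∘ involutive)
  ... | _       | no ¬edge = no (¬edge ∘ matched)

  isMatching-cong : ∀ {S σ τ} → σ ≗ τ → IsMatching H S σ → IsMatching H S τ
  isMatching-cong {S} {σ} {τ} σ≗τ M = record { involutive = inv ; matched = edge }
    where
    inv : Involutive τ
    inv x = trans (sym (σ≗τ (τ x))) (trans (cong σ (sym (σ≗τ x))) (involutive M x))
    edge : ∀ x → τ x ≢ x → S x ≡ true × adj H x (τ x) ≡ true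
    edge x τx≢x with matched M x (τx≢x ∘ trans (sym (σ≗τ x)))
    ... | Sx , edge-σ = Sx , subst (λ y → adj H x y ≡ true) (σ≗τ x) edge-σ

  id-isMatching : ∀ S → IsMatching H S (λ x → x)
  id-isMatching S = record { involutive = λ x → refl ; matched = λ x x≢x → ⊥-elim (x≢x refl) }

  isMatching-⊆ : ∀ {S T σ} → S ⊆ T → IsMatching H S σ → IsMatching H T σ
  isMatching-⊆ S⊆T M = record
    { involutive = involutive M
    ; matched    = λ x σx≢x → S⊆T x (proj₁ (matched M x σx≢x)) , proj₂ (matched M x σx≢x)
    }

  partner-∈ : ∀ {S σ} → IsMatching H S σ → ∀ x → σ x ≢ x → S (σ x) ≡ true
  partner-∈ {σ = σ} M x σx≢x =
    proj₁ (matched M (σ x) (λ σσx≡σx → σx≢x (sym (trans (sym (involutive M x)) σσx≡σx))))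

  fixed-outside : ∀ {S σ} → IsMatching H S σ → ∀ x → S x ≡ false → σ x ≡ x
  fixed-outside {σ = σ} M x Sx with σ x ≟ x
  ... | yes σx≡x = σx≡x
  ... | no  σx≢x = ⊥-elim (true≢false (proj₁ (matched M x σx≢x)) Sx)

  invariant-under-matching : ∀ {S σ} → IsMatching H S σ → ∀ x → S x ≡ true → S (σ x) ≡ true
  invariant-under-matching {S} {σ} M x Sx with σ x ≟ x
  ... | yes σx≡x = subst (λ y → S y ≡ true) (sym σx≡x) Sx
  ... | no  σx≢x = partner-∈ M x σx≢x

  maximum-matching : ∀ S → ∃ (IsMaximum H S)
  maximum-matching S with greatest achievable? (_ , id-isMatching S , z≤n) n (λ k (σ , _ , k≤) → ≤-trans k≤ (count-≤ _))
    where
    Achievable : ℕ → Set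
    Achievable k = ∃ λ σ → IsMatching H S σ × k ≤ moved σ
    achievable? : ∀ k → Dec (Achievable k)
    achievable? k = any-function? (λ σ≗τ (M , k≤) → isMatching-cong σ≗τ M , subst (k ≤_) (moved-cong σ≗τ) k≤)
                                  (λ σ → isMatching? S σ ×-dec (k ≤? moved σ))
  ... | k , (σ , M , k≤) , greatest-k = σ , M , λ τ N → ≤-trans (greatest-k (moved τ) (τ , N , ≤-refl)) k≤


  switch-isMatching : ∀ {S K σ τ} → IsMatching H S σ → IsMatching H S τ → Invariant K σ → Invariant K τ →
                      IsMatching H S (switch K σ τ)
  switch-isMatching {S} {K} {σ} {τ} M N Kσ Kτ = record
    { involutive = switch-involutive (involutive M) (involutive N) Kσ Kτ
    ; matched    = edge
    }
    where
    edge : ∀ x → switch K σ τ x ≢ x → S x ≡ true × adj H x (switch K σ τ x) ≡ true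
    edge x with K x
    ... | true  = matched M x
    ... | false = matched N x

  union-isMatching : ∀ {S C σ τ} → C ⊆ S → IsMatching H C σ → IsMatching H (S ∖ C) τ → IsMatching H S (switch C σ τ)
  union-isMatching {S} {C} {τ = τ} C⊆S M N =
    switch-isMatching (isMatching-⊆ C⊆S M) (isMatching-⊆ ∖-⊆ N) (invariant-under-matching M) C-fixed-by-τ
    where
    C-fixed-by-τ : Invariant C τ
    C-fixed-by-τ x Cx = subst (λ y → C y ≡ true) (sym (fixed-outside N x (∖-out S C x Cx))) Cx

  augment-isMatching : ∀ {S σ u v} → IsMatching H S σ → σ u ≡ u → σ v ≡ v → u ≢ v →
                       S u ≡ true → S v ≡ true → adj H u v ≡ true → IsMatching H S (augment u v σ)
  augment-isMatching {S} {σ} {u} {v} M σu σv u≢v Su Sv uv = record { involutive = inv ; matched = edge }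
    where
    only-u↦u : ∀ x → x ≢ u → σ x ≢ u
    only-u↦u x x≢u σx≡u = x≢u (trans (sym (involutive M x)) (trans (cong σ σx≡u) σu))
    only-v↦v : ∀ x → x ≢ v → σ x ≢ v
    only-v↦v x x≢v σx≡v = x≢v (trans (sym (involutive M x)) (trans (cong σ σx≡v) σv))
    inv : Involutive (augment u v σ)
    inv x with x ≟ u | x ≟ v
    ... | yes refl | _ rewrite ≢⇒≡ᵇ-false (u≢v ∘ sym) | ≡ᵇ-refl v = refl
    ... | no x≢u | yes refl rewrite ≡ᵇ-refl u = refl
    ... | no x≢u | no x≢v rewrite ≢⇒≡ᵇ-false (only-u↦u x x≢u) | ≢⇒≡ᵇ-false (only-v↦v x x≢v) = involutive M x
    edge : ∀ x → augment u v σ x ≢ x → S x ≡ true × adj H x (augment u v σ x) ≡ true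
    edge x with x ≟ u | x ≟ v
    ... | yes refl | _ = λ _ → Su , uv
    ... | no x≢u | yes refl = λ _ → Sv , trans (SimpleGraph.sym H v u) uv
    ... | no x≢u | no x≢v = matched M x

  moved-augment : ∀ {σ} (u v : Fin n) → σ u ≡ u → σ v ≡ v → u ≢ v → moved σ < moved (augment u v σ)
  moved-augment {σ} u v σu σv u≢v = count-mono-< still-moved u u-was-fixed u-now-moved
    where
    still-moved : ∀ x → not (fixedᵇ σ x) ≡ true → not (fixedᵇ (augment u v σ) x) ≡ true
    still-moved x σx≢x with x ≟ u | x ≟ v
    ... | yes refl | _      rewrite ≢⇒≡ᵇ-false (u≢v ∘ sym) = refl
    ... | no _     | yes refl rewrite ≢⇒≡ᵇ-false u≢v = refl
    ... | no _     | no _   = σx≢x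
    u-was-fixed : not (fixedᵇ σ u) ≡ false
    u-was-fixed rewrite σu | ≡ᵇ-refl u = refl
    u-now-moved : not (fixedᵇ (augment u v σ) u) ≡ true
    u-now-moved rewrite ≡ᵇ-refl u | ≢⇒≡ᵇ-false (u≢v ∘ sym) = refl

  exposed-nonadjacent : ∀ {S σ u v} → IsMaximum H S σ → σ u ≡ u → σ v ≡ v → u ≢ v →
                        S u ≡ true → S v ≡ true → adj H u v ≢ true
  exposed-nonadjacent {σ = σ} {u} {v} (M , max) σu σv u≢v Su Sv uv =
    <⇒≱ (moved-augment u v σu σv u≢v) (max _ (augment-isMatching M σu σv u≢v Su Sv uv))

  data Walk (S : Fin n → Bool) (u : Fin n) : Fin n → ℕ → Set where
    stay : Walk S u u 0
    step : ∀ {w v k} → Walk S u w k → S v ≡ true → adj H w v ≡ true → Walk S u v (suc k)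

  walk-end-∈ : ∀ {S u v k} → S u ≡ true → Walk S u v k → S v ≡ true
  walk-end-∈ Su stay           = Su
  walk-end-∈ Su (step _ Sv _)  = Sv

  walk-prepend : ∀ {S u w v k} → adj H u w ≡ true → S w ≡ true → Walk S w v k → Walk S u v (suc k)
  walk-prepend uw Sw stay             = step stay Sw uw
  walk-prepend uw Sw (step W Sv edge) = step (walk-prepend uw Sw W) Sv edge

  walk-reverse : ∀ {S u v k} → S u ≡ true → Walk S u v k → Walk S v u k
  walk-reverse Su stay                     = stay
  walk-reverse {v = v} Su (step {w} W _ wv) = walk-prepend (trans (SimpleGraph.sym H v w) wv) (walk-end-∈ Su W) (walk-reverse Su W)

  walk-append : ∀ {S u w v j k} → Walk S u w j → Walk S w v k → Walk S u v (k + j)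
  walk-append W stay             = W
  walk-append W (step V Sv edge) = step (walk-append W V) Sv edge

  Connected : (Fin n → Bool) → Set
  Connected S = ∀ u v → S u ≡ true → S v ≡ true → ∃ (Walk S u v)

  Closed : (Fin n → Bool) → (Fin n → Bool) → Set
  Closed S C = ∀ w y → C w ≡ true → S y ≡ true → adj H w y ≡ true → C y ≡ true

  module Component (S : Fin n → Bool) {x₀ : Fin n} (Sx₀ : S x₀ ≡ true) where

    reach : ℕ → Fin n → Bool
    reach zero    y = y ≡ᵇ x₀
    reach (suc k) y = reach k y ∨ (S y ∧ does (any? λ w → (reach k w ∧ adj H w y) ≟ᵇ true))

    ∨-elim : ∀ {a b} → a ∨ b ≡ true → a ≡ true ⊎ b ≡ true
    ∨-elim {true}  _ = inj₁ refl
    ∨-elim {false} b = inj₂ b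

    reach-next : ∀ k {w y} → reach k w ≡ true → S y ≡ true → adj H w y ≡ true → reach (suc k) y ≡ true
    reach-next k {w} {y} w∈ Sy wy rewrite Sy
      | dec-true (any? λ w → (reach k w ∧ adj H w y) ≟ᵇ true) (w , cong₂ _∧_ w∈ wy) = ∨-zeroʳ (reach k y)

    reach-walk : ∀ k y → reach k y ≡ true → ∃ (Walk S x₀ y)
    reach-walk zero    y y≡x₀ with refl ← ≡ᵇ⇒≡ {x = y} y≡x₀ = 0 , stay
    reach-walk (suc k) y y∈ with ∨-elim y∈
    ... | inj₁ earlier = reach-walk k y earlier
    ... | inj₂ new with from-does (any? λ w → (reach k w ∧ adj H w y) ≟ᵇ true) (∧-conicalʳ _ _ new)
    ...   | w , w∈∧wy with reach-walk k w (∧-conicalˡ _ _ w∈∧wy)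
    ...     | j , W = suc j , step W (∧-conicalˡ _ _ new) (∧-conicalʳ _ _ w∈∧wy)

    reach-grows : ∀ k → reach k ⊆ reach (suc k)
    reach-grows k y y∈ rewrite y∈ = refl

    reach-stays : ∀ k → reach (suc k) ⊆ reach k → reach (suc (suc k)) ⊆ reach (suc k)
    reach-stays k stable y y∈ with ∨-elim y∈
    ... | inj₁ earlier = earlier
    ... | inj₂ new with from-does (any? λ w → (reach (suc k) w ∧ adj H w y) ≟ᵇ true) (∧-conicalʳ _ _ new)
    ...   | w , w∈∧wy = reach-next k (stable w (∧-conicalˡ _ _ w∈∧wy)) (∧-conicalˡ _ _ new) (∧-conicalʳ _ _ w∈∧wy)

    C : Fin n → Bool
    C = reach n

    x₀-∈ : C x₀ ≡ true
    x₀-∈ = reach-x₀ n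
      where
      reach-x₀ : ∀ k → reach k x₀ ≡ true
      reach-x₀ zero    = ≡ᵇ-refl x₀
      reach-x₀ (suc k) = reach-grows k x₀ (reach-x₀ k)

    C-⊆ : C ⊆ S
    C-⊆ y y∈ with reach-walk n y y∈
    ... | _ , W = walk-end-∈ Sx₀ W

    C-closed : Closed S C
    C-closed w y w∈ Sy wy = chain-stabilises reach reach-grows reach-stays y (reach-next n w∈ Sy wy)

    connected-if-⊆ : S ⊆ C → Connected S
    connected-if-⊆ S⊆C u v Su Sv with reach-walk n u (S⊆C u Su) | reach-walk n v (S⊆C v Sv)
    ... | _ , U | _ , V = _ , walk-append (walk-reverse Sx₀ U) V

  -- Gallai's lemma

  Inessential : (Fin n → Bool) → Fin n → Set
  Inessential S y = ∃ λ τ → IsMaximum H S τ × τ y ≡ y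

  as-large-as-maximum : ∀ {S σ τ} → IsMaximum H S σ → IsMatching H S τ → moved σ ≤ moved τ → IsMaximum H S τ
  as-large-as-maximum (_ , σ-max) N σ≤τ = N , λ ρ R → ≤-trans (σ-max ρ R) σ≤τ

  distance : (Fin n → Fin n) → (Fin n → Fin n) → ℕ
  distance σ τ = count (λ x → not (σ x ≡ᵇ τ x))

  module Exchange {S : Fin n → Bool} {σ τ : Fin n → Fin n} {w z : Fin n}
                  (σ-max : IsMaximum H S σ) (τ-max : IsMaximum H S τ)
                  (τw≡w : τ w ≡ w) (σz≢z : σ z ≢ z) (τz≡z : τ z ≡ z) (z≢w : z ≢ w) where

    σ-M : IsMatching H S σ
    σ-M = proj₁ σ-max

    τ-M : IsMatching H S τ
    τ-M = proj₁ τ-max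

    open AlternatingPath σ τ (involutive σ-M) (involutive τ-M) τz≡z σz≢z

    τ′ : Fin n → Fin n
    τ′ = switch K σ τ

    τ′-M : IsMatching H S τ′
    τ′-M = switch-isMatching σ-M τ-M K-σ K-τ

    balance : moved τ′ + count (λ x → K x ∧ fixedᵇ σ x) ≡ moved τ + count (λ x → K x ∧ fixedᵇ τ x)
    balance = moved-switch K σ τ

    z-τ-fixed : 1 ≤ count (λ x → K x ∧ fixedᵇ τ x)
    z-τ-fixed = witness⇒count-pos z (cong₂ _∧_ (K-X 0) (dec-true (τ z ≟ z) τz≡z))

    σ-moving-K⇒larger : (∀ x → K x ≡ true → σ x ≢ x) → moved τ < moved τ′
    σ-moving-K⇒larger σ-moves-K = begin-strict
      moved τ                                    <⟨ m<m+n (moved τ) z-τ-fixed ⟩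
      moved τ + count (λ x → K x ∧ fixedᵇ τ x)   ≡⟨ balance ⟨
      moved τ′ + count (λ x → K x ∧ fixedᵇ σ x)  ≡⟨ cong (moved τ′ +_) (count-zero no-σ-fixed) ⟩
      moved τ′ + 0                               ≡⟨ +-identityʳ _ ⟩
      moved τ′                                   ∎
      where
      open ≤-Reasoning
      no-σ-fixed : ∀ x → (K x ∧ fixedᵇ σ x) ≡ false
      no-σ-fixed x with K x in Kx
      ... | true  = dec-false (σ x ≟ x) (σ-moves-K x Kx)
      ... | false = refl

    τ′-maximum : IsMaximum H S τ′
    τ′-maximum = as-large-as-maximum τ-max τ′-M (+-cancelʳ-≤ _ (moved τ) (moved τ′) (begin
      moved τ + count (λ x → K x ∧ fixedᵇ σ x)   ≤⟨ +-monoʳ-≤ (moved τ) (≤-trans σ-fixed-≤1 z-τ-fixed) ⟩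
      moved τ + count (λ x → K x ∧ fixedᵇ τ x)   ≡⟨ balance ⟨
      moved τ′ + count (λ x → K x ∧ fixedᵇ σ x)  ∎))
      where
      open ≤-Reasoning
      σ-fixed-≤1 : count (λ x → K x ∧ fixedᵇ σ x) ≤ 1
      σ-fixed-≤1 = count-≤1 _ λ x y Kσx Kσy →
        σ-fixed-unique x y (∧-conicalˡ _ _ Kσx) (∧-conicalˡ _ _ Kσy)
                           (≡ᵇ⇒≡ (∧-conicalʳ _ _ Kσx)) (≡ᵇ⇒≡ (∧-conicalʳ _ _ Kσy))

    τ′-fixes-w : (∀ x → K x ≡ true → τ x ≡ x → x ≡ z) → τ′ w ≡ w
    τ′-fixes-w only-z with K w in Kw
    ... | true  = ⊥-elim (z≢w (sym (only-z w Kw τw≡w)))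
    ... | false = τw≡w

    closer : distance σ τ′ < distance σ τ
    closer = count-mono-< agrees-off-K z agrees-at-z differs-at-z
      where
      agrees-off-K : ∀ x → not (σ x ≡ᵇ τ′ x) ≡ true → not (σ x ≡ᵇ τ x) ≡ true
      agrees-off-K x differs with K x
      ... | true  = ⊥-elim (true≢false differs (cong not (≡ᵇ-refl (σ x))))
      ... | false = differs
      agrees-at-z : not (σ z ≡ᵇ τ′ z) ≡ false
      agrees-at-z rewrite K-X 0 | ≡ᵇ-refl (σ z) = refl
      differs-at-z : not (σ z ≡ᵇ τ z) ≡ true
      differs-at-z rewrite ≢⇒≡ᵇ-false (σz≢z ∘ flip trans τz≡z) = refl

    result : ∃ λ τ′ → IsMaximum H S τ′ × τ′ w ≡ w × distance σ τ′ < distance σ τ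
    result with shape
    ... | inj₁ σ-moves-K = ⊥-elim (<⇒≱ (σ-moving-K⇒larger σ-moves-K) (proj₂ τ-max τ′ τ′-M))
    ... | inj₂ only-z    = τ′ , τ′-maximum , τ′-fixes-w only-z , closer

  exchange : ∀ {S σ τ w z} → IsMaximum H S σ → IsMaximum H S τ → τ w ≡ w → σ z ≢ z → τ z ≡ z → z ≢ w →
             ∃ λ τ′ → IsMaximum H S τ′ × τ′ w ≡ w × distance σ τ′ < distance σ τ
  exchange = Exchange.result

  exposed-by-second-only : ∀ {S σ τ u v} → IsMaximum H S σ → IsMaximum H S τ → u ≢ v →
                           σ u ≡ u → σ v ≡ v → τ u ≢ u → τ v ≢ v →
                           ∀ w → ∃ λ z → (σ z ≢ z × τ z ≡ z) × z ≢ w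
  exposed-by-second-only {σ = σ} {τ} {u} {v} (σ-M , σ-max) (τ-M , τ-max) u≢v σu σv τu τv w
    with count-≥2⇒other {p = λ x → not (fixedᵇ σ x) ∧ fixedᵇ τ x} two w
    where
    σ-only : ∀ {x} → σ x ≡ x → τ x ≢ x → (fixedᵇ σ x ∧ not (fixedᵇ τ x)) ≡ true
    σ-only {x} σx τx rewrite dec-true (σ x ≟ x) σx | dec-false (τ x ≟ x) τx = refl
    two : 2 ≤ count (λ x → not (fixedᵇ σ x) ∧ fixedᵇ τ x)
    two = +-cancelˡ-≤ (moved τ) 2 _ (begin
      moved τ + 2                                                ≡⟨ cong (_+ 2) (≤-antisym (σ-max τ τ-M) (τ-max σ σ-M)) ⟩
      moved σ + 2
        ≤⟨ +-monoʳ-≤ (moved σ) (count-≥2 u v u≢v (σ-only σu τu) (σ-only σv τv)) ⟩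
      moved σ + count (λ x → fixedᵇ σ x ∧ not (fixedᵇ τ x))      ≡⟨ moved-balance σ τ ⟩
      moved τ + count (λ x → not (fixedᵇ σ x) ∧ fixedᵇ τ x)      ∎)
      where open ≤-Reasoning
  ... | z , σz∧τz , z≢w = z , (σz≢z , ≡ᵇ⇒≡ (∧-conicalʳ _ _ σz∧τz)) , z≢w
    where
    σz≢z : σ z ≢ z
    σz≢z σz≡z = true≢false (∧-conicalˡ _ _ σz∧τz) (cong not (dec-true (σ z ≟ z) σz≡z))

  module Gallai {S : Fin n → Bool} (inessential : ∀ y → S y ≡ true → Inessential S y) where

    NoExposedPairWithin : ℕ → Set
    NoExposedPairWithin k = ∀ {σ u v j} → IsMaximum H S σ → S u ≡ true → σ u ≡ u → σ v ≡ v → u ≢ v →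
                            Walk S u v j → j ≤ k → ⊥

    -- Exchanging τ along alternating paths of σ ∪ τ keeps w exposed and brings τ closer to σ,
    -- until τ exposes u (a closer pair than u, v) or v (adjacent to w).
    every-maximum-covers : ∀ {k σ u v w j} → NoExposedPairWithin k → IsMaximum H S σ → S u ≡ true →
                           σ u ≡ u → σ v ≡ v → u ≢ v → Walk S u w j → j ≤ k → S v ≡ true → adj H w v ≡ true →
                           ∀ τ → IsMaximum H S τ → τ w ≢ w
    every-maximum-covers {k} {σ} {u} {v} {w} {j} none σ-max Su σu σv u≢v W j≤k Sv wv τ τ-max τw =
      go (suc (distance σ τ)) τ τ-max τw ≤-refl
      where
      Sw : S w ≡ true
      Sw = walk-end-∈ Su W
      w≢v : w ≢ v
      w≢v refl = true≢false wv (loopless H w)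
      u≢w : u ≢ w
      u≢w refl = exposed-nonadjacent σ-max σu σv u≢v Su Sv wv
      go : ∀ b τ → IsMaximum H S τ → τ w ≡ w → distance σ τ < b → ⊥
      go (suc b) τ τ-max τw _ with τ u ≟ u | τ v ≟ v
      ... | yes τu | _      = none τ-max Su τu τw u≢w W j≤k
      ... | no _   | yes τv = exposed-nonadjacent τ-max τw τv w≢v Sw Sv wv
      go (suc b) τ τ-max τw closer-than-b | no τu | no τv
        with exposed-by-second-only σ-max τ-max u≢v σu σv τu τv w
      ... | z , (σz≢z , τz≡z) , z≢w with exchange σ-max τ-max τw σz≢z τz≡z z≢w
      ...   | τ′ , τ′-max , τ′w , closer = go b τ′ τ′-max τ′w (<-≤-trans closer (s≤s⁻¹ closer-than-b))

    no-exposed-pair : ∀ k → NoExposedPairWithin k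
    no-exposed-pair k       σ-max Su σu σv u≢v stay _ = u≢v refl
    no-exposed-pair (suc k) {σ} {u} {v} σ-max Su σu σv u≢v (step {w} W Sv wv) (s≤s j≤k) with σ w ≟ w
    ... | no σw≢w = every-maximum-covers (no-exposed-pair k) σ-max Su σu σv u≢v W j≤k Sv wv τ τ-max τw
      where
      missed-w = inessential w (walk-end-∈ Su W)
      τ = proj₁ missed-w
      τ-max = proj₁ (proj₂ missed-w)
      τw = proj₂ (proj₂ missed-w)
    ... | yes σw with w ≟ u
    ...   | yes refl = exposed-nonadjacent σ-max σw σv u≢v Su Sv wv
    ...   | no w≢u   = no-exposed-pair k σ-max Su σu σw (w≢u ∘ sym) W j≤k

  gallai : ∀ {S σ₀} → IsMaximum H S σ₀ → Connected S →
           (∀ y → S y ≡ true → Inessential S y) → count S ≤ suc (moved σ₀)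
  gallai {S} {σ₀} σ₀-max connected inessential with count S ≤? suc (moved σ₀)
  ... | yes ≤moved+1 = ≤moved+1
  ... | no  ≰moved+1 with count-≥2⇒pair (more-than-moved⇒two-fixed S σ₀ (≰⇒> ≰moved+1))
  ...   | u , v , u-exposed , v-exposed , u≢v =
    ⊥-elim (Gallai.no-exposed-pair inessential _ σ₀-max Su (≡ᵇ⇒≡ (∧-conicalʳ _ _ u-exposed))
                                   (≡ᵇ⇒≡ (∧-conicalʳ _ _ v-exposed)) u≢v
                                   (proj₂ (connected u v Su (∧-conicalˡ _ _ v-exposed))) ≤-refl)
    where
    Su = ∧-conicalˡ _ _ u-exposed

  -- Degree sums and the edge bound

  degreeSum : (Fin n → Bool) → ℕ
  degreeSum S = sum λ x → count λ y → S x ∧ S y ∧ adj H x y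

  edges-at : ∀ v → ΣΣ (λ x y → 𝟙 (x ≡ᵇ v ∧ adj H x y)) ≡ count (adj H v)
  edges-at v = trans (sum-single _ v not-v) (count-cong λ y → cong (_∧ adj H v y) (≡ᵇ-refl v))
    where
    not-v : ∀ x → x ≢ v → count (λ y → x ≡ᵇ v ∧ adj H x y) ≡ 0
    not-v x x≢v = count-zero λ y → cong (_∧ adj H x y) (≢⇒≡ᵇ-false x≢v)

  edges-at′ : ∀ v → ΣΣ (λ x y → 𝟙 (y ≡ᵇ v ∧ adj H x y)) ≡ count (adj H v)
  edges-at′ v = begin
    ΣΣ (λ x y → 𝟙 (y ≡ᵇ v ∧ adj H x y))  ≡⟨ ∑-comm (λ x y → 𝟙 (y ≡ᵇ v ∧ adj H x y)) ⟩
    ΣΣ (λ y x → 𝟙 (y ≡ᵇ v ∧ adj H x y))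
      ≡⟨ sum-cong-≗ (λ y → sum-cong-≗ λ x → cong (λ b → 𝟙 (y ≡ᵇ v ∧ b)) (SimpleGraph.sym H x y)) ⟩
    ΣΣ (λ y x → 𝟙 (y ≡ᵇ v ∧ adj H y x))  ≡⟨ edges-at v ⟩
    count (adj H v)                       ∎
    where open ≡-Reasoning

  degreeSum-+-count : ∀ S → degreeSum S + count S ≤ count S * count S
  degreeSum-+-count S = begin
    degreeSum S + count S
      ≡⟨ ∑-distrib-+ (λ x → count λ y → S x ∧ S y ∧ adj H x y) (𝟙 ∘ S) ⟨
    sum (λ x → count (λ y → S x ∧ S y ∧ adj H x y) + 𝟙 (S x)) ≤⟨ sum-mono-≤ pointwise ⟩
    sum (λ x → 𝟙 (S x) * count S)                           ≡⟨ *-distribʳ-sum (count S) (𝟙 ∘ S) ⟨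
    count S * count S                                       ∎
    where
    open ≤-Reasoning
    pointwise : ∀ x → count (λ y → S x ∧ S y ∧ adj H x y) + 𝟙 (S x) ≤ 𝟙 (S x) * count S
    pointwise x with S x in Sx
    ... | false = ≤-reflexive (cong (_+ 0) (count-zero {n} {λ _ → false} λ _ → refl))
    ... | true  = begin
      count (λ y → S y ∧ adj H x y) + 1              ≡⟨ cong (count (λ y → S y ∧ adj H x y) +_) (count-≡ᵇ x) ⟨
      count (λ y → S y ∧ adj H x y) + count (_≡ᵇ x)  ≡⟨ ∑-distrib-+ (λ y → 𝟙 (S y ∧ adj H x y)) (𝟙 ∘ (_≡ᵇ x)) ⟨
      sum (λ y → 𝟙 (S y ∧ adj H x y) + 𝟙 (y ≡ᵇ x))   ≤⟨ sum-mono-≤ neighbour-or-self ⟩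
      count S                                        ≡⟨ +-identityʳ (count S) ⟨
      count S + 0                                    ∎
      where
      neighbour-or-self : ∀ y → 𝟙 (S y ∧ adj H x y) + 𝟙 (y ≡ᵇ x) ≤ 𝟙 (S y)
      neighbour-or-self y with y ≟ x
      ... | yes refl rewrite Sx | loopless H y = ≤-refl
      ... | no  _    = ≤-trans (≤-reflexive (+-identityʳ _)) (𝟙-mono (∧-conicalˡ _ _))

  degreeSum-split : ∀ S C → Closed S C → degreeSum S ≤ degreeSum C + degreeSum (S ∖ C)
  degreeSum-split S C closed = ≤-trans (ΣΣ-mono-≤ pointwise) (≤-reflexive (ΣΣ-distrib-+ {n} _ _))
    where
    pointwise : ∀ x y → 𝟙 (S x ∧ S y ∧ adj H x y)
                        ≤ 𝟙 (C x ∧ C y ∧ adj H x y) + 𝟙 ((S x ∧ not (C x)) ∧ (S y ∧ not (C y)) ∧ adj H x y)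
    pointwise x y with S x in Sx | S y in Sy | adj H x y in xy
    ... | false | _     | _     = z≤n
    ... | true  | false | _     = z≤n
    ... | true  | true  | false = z≤n
    ... | true  | true  | true with C x in Cx | C y in Cy
    ...   | true  | true  = ≤-refl
    ...   | false | false = ≤-refl
    ...   | true  | false = ⊥-elim (true≢false (closed x y Cx Sy xy) Cy)
    ...   | false | true  = ⊥-elim (true≢false (closed y x Cy Sx (trans (SimpleGraph.sym H y x) xy)) Cx)

  Missable : (Fin n → Bool) → (Fin n → Fin n) → Fin n → Set
  Missable S σ₀ y = ∃ λ τ → IsMatching H S τ × moved σ₀ ≤ moved τ × τ y ≡ y

  missable? : ∀ S σ₀ y → Dec (Missable S σ₀ y)
  missable? S σ₀ y = any-function? respects (λ τ → isMatching? S τ ×-dec (moved σ₀ ≤? moved τ) ×-dec (τ y ≟ y))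
    where
    respects : ∀ {σ τ} → σ ≗ τ → IsMatching H S σ × moved σ₀ ≤ moved σ × σ y ≡ y →
                                 IsMatching H S τ × moved σ₀ ≤ moved τ × τ y ≡ y
    respects σ≗τ (M , big , fixes) =
      isMatching-cong σ≗τ M , subst (moved σ₀ ≤_) (moved-cong σ≗τ) big , trans (sym (σ≗τ y)) fixes

  module _ {Δ : ℕ} (degree≤Δ : ∀ x → count (adj H x) ≤ Δ) where

    degreeSum-≤ : ∀ S → degreeSum S ≤ count S * Δ
    degreeSum-≤ S = ≤-trans (sum-mono-≤ pointwise) (≤-reflexive (sym (*-distribʳ-sum Δ (𝟙 ∘ S))))
      where
      pointwise : ∀ x → count (λ y → S x ∧ S y ∧ adj H x y) ≤ 𝟙 (S x) * Δ
      pointwise x with S x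
      ... | true  = ≤-trans (count-mono {p = λ y → S y ∧ adj H x y} λ y → ∧-conicalʳ _ _)
                            (≤-trans (degree≤Δ x) (≤-reflexive (sym (+-identityʳ Δ))))
      ... | false = ≤-reflexive (count-zero {n} {λ _ → false} λ _ → refl)

    degreeSum-remove : ∀ S v → degreeSum S ≤ degreeSum (S ∖ (_≡ᵇ v)) + (Δ + Δ)
    degreeSum-remove S v = begin
      degreeSum S
        ≤⟨ ΣΣ-mono-≤ (λ x y → pointwise (S x) (S y) (adj H x y) (x ≡ᵇ v) (y ≡ᵇ v)) ⟩
      ΣΣ (λ x y → 𝟙 (S′ x ∧ S′ y ∧ adj H x y) + 𝟙 (x ≡ᵇ v ∧ adj H x y) + 𝟙 (y ≡ᵇ v ∧ adj H x y))
        ≡⟨ ΣΣ-distrib-+ {n} _ _ ⟩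
      ΣΣ (λ x y → 𝟙 (S′ x ∧ S′ y ∧ adj H x y) + 𝟙 (x ≡ᵇ v ∧ adj H x y))
        + ΣΣ (λ x y → 𝟙 (y ≡ᵇ v ∧ adj H x y))
        ≡⟨ cong₂ _+_ (ΣΣ-distrib-+ {n} _ _) (edges-at′ v) ⟩
      degreeSum S′ + ΣΣ (λ x y → 𝟙 (x ≡ᵇ v ∧ adj H x y)) + count (adj H v)
        ≡⟨ cong (λ e → degreeSum S′ + e + count (adj H v)) (edges-at v) ⟩
      degreeSum S′ + count (adj H v) + count (adj H v)
        ≤⟨ ≤-reflexive (+-assoc (degreeSum S′) _ _) ⟩
      degreeSum S′ + (count (adj H v) + count (adj H v))
        ≤⟨ +-monoʳ-≤ (degreeSum S′) (+-mono-≤ (degree≤Δ v) (degree≤Δ v)) ⟩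
      degreeSum S′ + (Δ + Δ)
        ∎
      where
      open ≤-Reasoning
      S′ = S ∖ (_≡ᵇ v)
      pointwise : ∀ s t a e f → 𝟙 (s ∧ t ∧ a) ≤ 𝟙 ((s ∧ not e) ∧ (t ∧ not f) ∧ a) + 𝟙 (e ∧ a) + 𝟙 (f ∧ a)
      pointwise false t     a     e     f     = z≤n
      pointwise true  false a     e     f     = z≤n
      pointwise true  true  false e     f     = z≤n
      pointwise true  true  true  true  f     = s≤s z≤n
      pointwise true  true  true  false true  = s≤s z≤n
      pointwise true  true  true  false false = s≤s z≤n

    -- |E(H[S])| ≤ (Δ + 1) ν(H[S]), both sides doubled.
    Bounded : (Fin n → Bool) → Set
    Bounded S = ∃ λ σ → IsMatching H S σ × degreeSum S ≤ suc Δ * moved σ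

    bounded-if-empty : ∀ S → count S ≡ 0 → Bounded S
    bounded-if-empty S empty =
      (λ x → x) , id-isMatching S , ≤-trans (degreeSum-≤ S) (≤-trans (≤-reflexive (cong (_* Δ) empty)) z≤n)

    bounded-if-essential : ∀ {S σ₀ v} → IsMaximum H S σ₀ → S v ≡ true →
                           ¬ Missable S σ₀ v → Bounded (S ∖ (_≡ᵇ v)) → Bounded S
    bounded-if-essential {S} {σ₀} {v} σ₀-max Sv v-covered (σ , M , bound) = σ₀ , proj₁ σ₀-max , (begin
      degreeSum S                       ≤⟨ degreeSum-remove S v ⟩
      degreeSum (S ∖ (_≡ᵇ v)) + (Δ + Δ) ≤⟨ +-monoˡ-≤ (Δ + Δ) bound ⟩
      suc Δ * moved σ + (Δ + Δ)         ≤⟨ m≤n+m _ 2 ⟩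
      2 + (suc Δ * moved σ + (Δ + Δ))   ≡⟨ distribute Δ (moved σ) ⟨
      suc Δ * (2 + moved σ)             ≤⟨ *-monoʳ-≤ (suc Δ) gap ⟩
      suc Δ * moved σ₀                  ∎)
      where
      open ≤-Reasoning
      distribute : ∀ Δ m → suc Δ * (2 + m) ≡ 2 + (suc Δ * m + (Δ + Δ))
      distribute = solve-∀
      smaller : moved σ < moved σ₀
      smaller = ≰⇒> λ σ₀≤σ → v-covered (σ , isMatching-⊆ ∖-⊆ M , σ₀≤σ , fixed-outside M v (∖-out S (_≡ᵇ v) v (≡ᵇ-refl v)))
      gap : 2 + moved σ ≤ moved σ₀
      gap = moved-<⇒2+≤ {σ = σ} {σ₀} (involutive M) (involutive (proj₁ σ₀-max)) smaller

    bounded-if-split : ∀ {S C} → C ⊆ S → Closed S C → Bounded C → Bounded (S ∖ C) → Bounded S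
    bounded-if-split {S} {C} C⊆S closed (σ₁ , M₁ , bound₁) (σ₂ , M₂ , bound₂) =
      switch C σ₁ σ₂ , union-isMatching C⊆S M₁ M₂ , (begin
      degreeSum S                          ≤⟨ degreeSum-split S C closed ⟩
      degreeSum C + degreeSum (S ∖ C)      ≤⟨ +-mono-≤ bound₁ bound₂ ⟩
      suc Δ * moved σ₁ + suc Δ * moved σ₂  ≡⟨ *-distribˡ-+ (suc Δ) (moved σ₁) (moved σ₂) ⟨
      suc Δ * (moved σ₁ + moved σ₂)        ≡⟨ cong (suc Δ *_) (moved-switch-disjoint C σ₁ σ₂ σ₂-fixes-C σ₁-fixes-rest) ⟨
      suc Δ * moved (switch C σ₁ σ₂)       ∎)
      where
      open ≤-Reasoning
      σ₂-fixes-C : ∀ x → C x ≡ true → σ₂ x ≡ x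
      σ₂-fixes-C x Cx = fixed-outside M₂ x (∖-out S C x Cx)
      σ₁-fixes-rest : ∀ x → C x ≡ false → σ₁ x ≡ x
      σ₁-fixes-rest = fixed-outside M₁

    bounded-if-connected-inessential : ∀ {S σ₀} → IsMaximum H S σ₀ → Connected S →
                             (∀ y → S y ≡ true → Inessential S y) → Bounded S
    bounded-if-connected-inessential {S} {σ₀} σ₀-max connected inessential =
      σ₀ , proj₁ σ₀-max , near-perfect-bound (degreeSum-≤ S) (degreeSum-+-count S) (gallai σ₀-max connected inessential)

    bounded-if-all-inessential : ∀ {b S σ₀ x₀} → count S ≤ suc b → (∀ S′ → count S′ ≤ b → Bounded S′) → IsMaximum H S σ₀ →
                            (∀ y → S y ≡ true → Inessential S y) → S x₀ ≡ true → Bounded S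
    bounded-if-all-inessential {b} {S} {x₀ = x₀} S≤b+1 bounded-below σ₀-max inessential Sx₀ =
      [ connected , disconnected ]′ (⊆-or-witness S C)
      where
      open Component S Sx₀
      connected : S ⊆ C → Bounded S
      connected S⊆C = bounded-if-connected-inessential σ₀-max (connected-if-⊆ S⊆C) inessential
      disconnected : ∃ (λ y → S y ≡ true × C y ≡ false) → Bounded S
      disconnected (y , Sy , y∉C) =
        bounded-if-split C-⊆ C-closed (bounded-below C (count-shrinks S≤b+1 C-⊆ y y∉C Sy))
                                      (bounded-below (S ∖ C) (count-shrinks S≤b+1 ∖-⊆ x₀ (∖-out S C x₀ x₀-∈) Sx₀))

    bounded : ∀ b S → count S ≤ b → Bounded S
    bounded zero    S S≤0   = bounded-if-empty S (n≤0⇒n≡0 S≤0)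
    bounded (suc b) S S≤b+1 = [ all-missable , some-essential ]′ (every-or-counterexample (missable? S σ₀) S)
      where
      σ₀ = proj₁ (maximum-matching S)
      σ₀-max = proj₂ (maximum-matching S)
      some-essential : ∃ (λ v → S v ≡ true × ¬ Missable S σ₀ v) → Bounded S
      some-essential (v , Sv , v-covered) =
        bounded-if-essential σ₀-max Sv v-covered
                             (bounded b _ (count-shrinks S≤b+1 ∖-⊆ v (∖-out S (_≡ᵇ v) v (≡ᵇ-refl v)) Sv))
      all-missable : (∀ y → S y ≡ true → Missable S σ₀ y) → Bounded S
      all-missable missed = [ bounded-if-all-inessential S≤b+1 (bounded b) σ₀-max inessential ∘ proj₂ , bounded-if-empty S ]′
                            (witness-or-count-zero S)
        where
        inessential : ∀ y → S y ≡ true → Inessential S y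
        inessential y Sy = let τ , M , big , τy = missed y Sy in τ , as-large-as-maximum σ₀-max M big , τy

  toMatching : ∀ {S σ} → IsMatching H S σ → Matching (adj H)
  toMatching {σ = σ} M = record
    { edges    = map (λ x → x , σ x) (ascending σ)
    ; isEdge   = All.map⁺ (All.map (λ x<σx → proj₂ (matched M _ (λ σx≡x → <-irrefl (sym σx≡x) x<σx)))
                                   (all-filter (λ x → x <? σ x) (allFin n)))
    ; disjoint = endpoints-unique (involutive M)
    }

  covered-toMatching : ∀ {S σ} (M : IsMatching H S σ) → covered (toMatching M) ≡ moved σ
  covered-toMatching {σ = σ} M = begin
    covered (toMatching M)                     ≡⟨ length-endpoints σ (ascending σ) ⟩
    length (ascending σ) + length (ascending σ) ≡⟨ cong₂ _+_ (length-ascending σ) (length-ascending σ) ⟩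
    ascents σ + ascents σ                      ≡⟨ moved≡ascents+ascents {σ = σ} (involutive M) ⟨
    moved σ                                    ∎
    where open ≡-Reasoning

  regular-matching : ∀ {d} → (∀ x → count (adj H x) ≡ d) → Σ (Matching (adj H)) λ M → n * d ≤ suc d * covered M
  regular-matching {d} regular with bounded (≤-reflexive ∘ regular) n (λ _ → true) (count-≤ _)
  ... | σ , M , bound = toMatching M , (begin
    n * d                  ≡⟨ sum-const {n} d ⟨
    sum {n} (λ _ → d)      ≡⟨ sum-cong-≗ regular ⟨
    degreeSum (λ _ → true) ≤⟨ bound ⟩
    suc d * moved σ        ≡⟨ cong (suc d *_) (covered-toMatching M) ⟨
    suc d * covered (toMatching M) ∎)
    where open ≤-Reasoning

-- The complement of a regular graph

complementAdj≡ : ∀ {n} (G : SimpleGraph n) x y → complementAdj G x y ≡ not (adj G x y) ∧ not (x ≡ᵇ y)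
complementAdj≡ G x y = cong (λ e → not (adj G x y) ∧ not e) (isYes≗does (x ≟ y))

complement : ∀ {n} → SimpleGraph n → SimpleGraph n
complement G = record
  { adj      = complementAdj G
  ; sym      = λ i j → begin
      complementAdj G i j             ≡⟨ complementAdj≡ G i j ⟩
      not (adj G i j) ∧ not (i ≡ᵇ j)  ≡⟨ cong₂ (λ a e → not a ∧ not e) (SimpleGraph.sym G i j) (≡ᵇ-sym i j) ⟩
      not (adj G j i) ∧ not (j ≡ᵇ i)  ≡⟨ complementAdj≡ G j i ⟨
      complementAdj G j i             ∎
  ; loopless = λ i → trans (complementAdj≡ G i i) (trans (cong (λ e → not (adj G i i) ∧ not e) (≡ᵇ-refl i)) (∧-zeroʳ _))
  }
  where open ≡-Reasoning

degree≡count : ∀ {n} (G : SimpleGraph n) x → degree G x ≡ count (adj G x)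
degree≡count G x =
  trans (length-filter-tabulate (λ y → adj G x y ≟ᵇ true) (λ y → y)) (sum-cong-≗ (cong 𝟙 ∘ does-≟true ∘ adj G x))
  where
  does-≟true : ∀ b → does (b ≟ᵇ true) ≡ b
  does-≟true true  = refl
  does-≟true false = refl

complement-degree : ∀ {n} (G : SimpleGraph n) x → count (complementAdj G x) + degree G x + 1 ≡ n
complement-degree {n} G x = begin
  count (complementAdj G x) + degree G x + 1
    ≡⟨ cong₂ (λ d e → count (complementAdj G x) + d + e) (degree≡count G x) (sym (count-≡ᵇ x)) ⟩
  count (complementAdj G x) + count (adj G x) + count (_≡ᵇ x)
    ≡⟨ cong (_+ count (_≡ᵇ x)) (∑-distrib-+ (𝟙 ∘ complementAdj G x) (𝟙 ∘ adj G x)) ⟨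
  sum (λ y → 𝟙 (complementAdj G x y) + 𝟙 (adj G x y)) + count (_≡ᵇ x)
    ≡⟨ ∑-distrib-+ (λ y → 𝟙 (complementAdj G x y) + 𝟙 (adj G x y)) (𝟙 ∘ (_≡ᵇ x)) ⟨
  sum (λ y → 𝟙 (complementAdj G x y) + 𝟙 (adj G x y) + 𝟙 (y ≡ᵇ x))
    ≡⟨ sum-cong-≗ exactly-one ⟩
  sum {n} (λ _ → 1)
    ≡⟨ trans (sum-const {n} 1) (*-identityʳ n) ⟩
  n ∎
  where
  open ≡-Reasoning
  exactly-one : ∀ y → 𝟙 (complementAdj G x y) + 𝟙 (adj G x y) + 𝟙 (y ≡ᵇ x) ≡ 1
  exactly-one y rewrite complementAdj≡ G x y | ≡ᵇ-sym y x with x ≟ y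
  ... | yes refl rewrite loopless G x = refl
  ... | no _ with adj G x y
  ...   | true  = refl
  ...   | false = refl

module _ {n r : ℕ} (G : SimpleGraph (suc n)) (regular : Regular G r) where

  non-neighbours+r : ∀ x → count (complementAdj G x) + r ≡ n
  non-neighbours+r x = +-cancelʳ-≡ 1 _ n (begin
    count (complementAdj G x) + r + 1           ≡⟨ cong (λ d → count (complementAdj G x) + d + 1) (regular x) ⟨
    count (complementAdj G x) + degree G x + 1  ≡⟨ complement-degree G x ⟩
    suc n                                        ≡⟨ +-comm 1 n ⟩
    n + 1                                        ∎)
    where open ≡-Reasoning

  complement-regular : ∀ x → count (complementAdj G x) ≡ n ∸ r
  complement-regular x = trans (sym (m+n∸n≡m _ r)) (cong (_∸ r) (non-neighbours+r x))

  r≤n : r ≤ n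
  r≤n = subst (r ≤_) (non-neighbours+r zero) (m≤n+m r _)

lemma5 : ∀ (n r : ℕ) (G : SimpleGraph n) → Regular G r →
    Σ (Matching (complementAdj G)) (λ M →
    covered M * (n ∸ r) + n ≥ n * (n ∸ r))
lemma5 zero    r G regular = record { edges = [] ; isEdge = [] ; disjoint = [] } , z≤n
lemma5 (suc n) r G regular = M , subst (λ k → covered M * k + suc n ≥ suc n * k) (sym n+1∸r≡d+1) (begin
  suc n * suc d             ≡⟨ *-suc (suc n) d ⟩
  suc n + suc n * d         ≤⟨ +-monoʳ-≤ (suc n) bound ⟩
  suc n + suc d * covered M ≡⟨ +-comm (suc n) _ ⟩
  suc d * covered M + suc n ≡⟨ cong (_+ suc n) (*-comm (suc d) (covered M)) ⟩
  covered M * suc d + suc n ∎)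
  where
  open ≤-Reasoning
  d = n ∸ r
  n+1∸r≡d+1 : suc n ∸ r ≡ suc d
  n+1∸r≡d+1 = +-∸-assoc 1 (r≤n G regular)
  M = proj₁ (regular-matching (complement G) (complement-regular G regular))
  bound = proj₂ (regular-matching (complement G) (complement-regular G regular))
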